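{- For all integers $n\ge 1$ and $0 \leq m \leq n-1$, the simplicial complex $\Delta_{n,m}$ is a normal $(n-1)$-pseudomanifold (possibly with nonempty boundary).
   Context: For $v\in\mathbb{R}^n$, $\mathrm{sgn}(v)\in\{ -,0,+\}^n$ is the vector of signs of its entries, considered up to global negation. The sign variation $\mathrm{var}$ of a vector or sign vector is the number of sign changes after deleting zero entries. $P_{n,m}$ is the poset whose elements are the nonzero sign vectors $\omega\in\{ -,0,+\}^n$ (up to global negation) with $\mathrm{var}(\omega)\le m$, ordered by $\omega'\leq\omega$ iff $\omega'$ is obtained from $\omega$ by replacing some nonzero entries by $0$ (the closure poset of the regular CW structure on $\{v\in\mathbb{RP}^{n-1}:\mathrm{var}(v)\le m\}$ with cells $U_\omega=\{v:\mathrm{sgn}(v)=\omega\}$). $\Delta_{n,m}$ is the order complex of $P_{n,m}$ (faces = nonempty chains). For a face $F$ of $\Delta$, $\mathrm{lk}_\Delta(F)=\{G\in\Delta:F\cup G\in\Delta, F\cap G=\varnothing\}$. A simplicial complex $\Delta$ is a normal $d$-pseudomanifold if (1) it is pure of dimension $d$, (2) every $(d-1)$-dimensional face lies in at most two facets, and (3) for every face $F$ with $\dim F<d-2$ the link $\mathrm{lk}_\Delta(F)$ is connected. -}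

module Defs where

open import Level using (Level; _⊔_) renaming (suc to lsuc)
open import Data.Nat using (ℕ; zero; suc; _+_; _≤_; _<_)
open import Data.Fin using (Fin)
open import Data.Vec using (Vec; lookup; toList)
open import Data.List using (List; []; _∷_; _++_; length)
open import Data.List.Membership.Propositional using (_∈_)
open import Data.List.Relation.Binary.Subset.Propositional using (_⊆_)
open import Data.List.Relation.Unary.All using (All)
open import Data.List.Relation.Unary.Unique.Propositional using (Unique)
open import Data.Product using (_×_; Σ; ∃)
open import Data.Sum using (_⊎_)
open import Data.Empty using (⊥)
open import Relation.Binary.PropositionalEquality using (_≡_; _≢_)

data Sign : Set where
  neg zer pos : Sign

negate : Sign → Sign
negate neg = pos
negate zer = zer
negate pos = neg

nonzeros : List Sign → List Sign
nonzeros []          = []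
nonzeros (zer ∷ xs)  = nonzeros xs
nonzeros (neg ∷ xs)  = neg ∷ nonzeros xs
nonzeros (pos ∷ xs)  = pos ∷ nonzeros xs

differ : Sign → Sign → ℕ
differ neg pos = 1
differ pos neg = 1
differ _   _   = 0

changes : List Sign → ℕ
changes []           = 0
changes (x ∷ [])     = 0
changes (x ∷ y ∷ r)  = differ x y + changes (y ∷ r)

var : ∀ {n} → Vec Sign n → ℕ
var ω = changes (nonzeros (toList ω))

firstNonzero : List Sign → Sign
firstNonzero []         = zer
firstNonzero (zer ∷ xs) = firstNonzero xs
firstNonzero (neg ∷ _)  = neg
firstNonzero (pos ∷ _)  = pos

-- Sign vectors are taken up to global negation; we use the canonical
-- representative whose first nonzero entry is pos.  This also forces
-- the vector to be nonzero.
Canonical : ∀ {n} → Vec Sign n → Set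
Canonical ω = firstNonzero (toList ω) ≡ pos

InP : (n m : ℕ) → Vec Sign n → Set
InP n m ω = Canonical ω × var ω ≤ m

-- ω' ≤ ω : ω' is obtained from (a representative ±ω of) ω by
-- replacing some nonzero entries with zero
_≤P_ : ∀ {n} → Vec Sign n → Vec Sign n → Set
_≤P_ {n} ω' ω =
  ((i : Fin n) → lookup ω' i ≡ zer ⊎ lookup ω' i ≡ lookup ω i)
  ⊎ ((i : Fin n) → lookup ω' i ≡ zer ⊎ lookup ω' i ≡ negate (lookup ω i))

-- Simplicial complexes given by a predicate on finite vertex sets,
-- finite sets being duplicate-free lists (considered up to order).

-- The order complex Δ_{n,m}: faces are nonempty chains of P_{n,m}.
OrderComplexFace : (n m : ℕ) → List (Vec Sign n) → Set
OrderComplexFace n m F =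
  F ≢ [] × Unique F × All (InP n m) F
  × (∀ {x y} → x ∈ F → y ∈ F → x ≤P y ⊎ y ≤P x)

module _ {V : Set} where

  _≋_ : List V → List V → Set
  F ≋ G = F ⊆ G × G ⊆ F

  Disjoint : List V → List V → Set
  Disjoint F G = ∀ {x} → x ∈ F → x ∈ G → ⊥

  Facet : (List V → Set) → List V → Set
  Facet Face F = Face F × (∀ G → Face G → F ⊆ G → G ⊆ F)

  Link : (List V → Set) → List V → List V → Set
  Link Face F G = Face G × Face (F ++ G) × Disjoint F G

  data Walk (K : List V → Set) : V → V → Set where
    here : ∀ {v} → Walk K v v
    step : ∀ {u v w} → K (u ∷ v ∷ []) → Walk K v w → Walk K u w

  Connected : (List V → Set) → Set
  Connected K = ∀ v w → K (v ∷ []) → K (w ∷ []) → Walk K v w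

  -- dimension of a face F is length F - 1
  Pure : ℕ → (List V → Set) → Set
  Pure d Face =
    (Σ (List V) λ F → Face F × length F ≡ suc d)
    × (∀ F → Facet Face F → length F ≡ suc d)

  NormalPseudomanifold : ℕ → (List V → Set) → Set
  NormalPseudomanifold d Face =
    Pure d Face
    -- every (d-1)-dimensional face lies in at most two facets
    × (∀ F → Face F → length F ≡ d →
         ∀ G₁ G₂ G₃ → Facet Face G₁ → Facet Face G₂ → Facet Face G₃ →
         F ⊆ G₁ → F ⊆ G₂ → F ⊆ G₃ →
         G₁ ≋ G₂ ⊎ G₁ ≋ G₃ ⊎ G₂ ≋ G₃)
    -- dim F < d - 2, i.e. (length F - 1) < d - 2, i.e. length F + 1 < d
    × (∀ F → Face F → suc (length F) < d → Connected (Link Face F))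

-- Vertices are canonical sign vectors (first nonzero entry +) of variation ≤ m,
-- x ≼ y iff x arises from ±y by zeroing entries, and the rank is the number of
-- nonzero entries; a face is a chain and sorts into a rank-increasing list.  Purity: the prefixes (+,0,..) < (+,+,0,..) < ... form a face
-- of n vertices, and a chain missing a rank can be refined.  Thinness: a face of
-- n-1 vertices misses one rank, which can be filled in at most two ways.  Links:
-- two link vertices are separated by a vertex of the face, or share a gap of at
-- least four ranks, connected by join/meet moves or, in the top gap, via a hub.
module Submission where

open import Defs
open import Data.Nat using (ℕ; zero; suc; _+_; _≤_; _<_; _∸_; z≤n; s≤s; _≟_; _≤?_)
open import Data.Nat.Properties
open import Data.Nat.Solver using (module +-*-Solver)
open import Data.Fin using (Fin; zero; suc)
import Data.Fin.Properties as FP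
open import Data.Vec using (Vec; []; _∷_; lookup; toList; replicate; _[_]≔_) renaming (map to vmap)
import Data.Vec.Properties as VP
open import Data.List using (List; []; _∷_; _++_; length)
open import Data.List.Membership.Propositional using (_∈_; _∉_)
open import Data.List.Membership.Propositional.Properties using (∈-++⁻; ∈-++⁺ˡ; ∈-++⁺ʳ)
open import Data.List.Relation.Binary.Subset.Propositional using (_⊆_)
open import Data.List.Relation.Unary.Any using (here; there)
open import Data.List.Relation.Unary.All as All using (All; []; _∷_)
import Data.List.Relation.Unary.All.Properties as AllP
open import Data.List.Relation.Unary.AllPairs using ([]; _∷_)
open import Data.List.Relation.Unary.Unique.Propositional using (Unique)
import Data.List.Relation.Unary.Unique.Propositional.Properties as UP
open import Data.Maybe using (Maybe; just; nothing)
open import Data.Product using (_×_; _,_; proj₁; proj₂; Σ)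
open import Data.Sum using (_⊎_; inj₁; inj₂)
open import Data.Empty using (⊥; ⊥-elim)
open import Data.Unit using (⊤; tt)
open import Relation.Nullary using (Dec; yes; no)
open import Relation.Binary.PropositionalEquality hiding (J)

open +-*-Solver using (solve; _:=_; _:+_; con)

_≟S_ : (s t : Sign) → Dec (s ≡ t)
neg ≟S neg = yes refl
neg ≟S zer = no (λ ())
neg ≟S pos = no (λ ())
zer ≟S neg = no (λ ())
zer ≟S zer = yes refl
zer ≟S pos = no (λ ())
pos ≟S neg = no (λ ())
pos ≟S zer = no (λ ())
pos ≟S pos = yes refl

Nonzero : Sign → Set
Nonzero s = s ≡ zer → ⊥

weight : Sign → ℕ
weight zer = 0
weight neg = 1
weight pos = 1

weight-nonzero : ∀ s → Nonzero s → weight s ≡ 1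
weight-nonzero neg _ = refl
weight-nonzero zer h = ⊥-elim (h refl)
weight-nonzero pos _ = refl

weight-neg : ∀ s → weight (negate s) ≡ weight s
weight-neg neg = refl
weight-neg zer = refl
weight-neg pos = refl

negate-inv : ∀ s → negate (negate s) ≡ s
negate-inv neg = refl
negate-inv zer = refl
negate-inv pos = refl

ZeroOrEq : Sign → Sign → Set
ZeroOrEq s t = s ≡ zer ⊎ s ≡ t

zeroOrEq-both-signs : ∀ {s t} → ZeroOrEq s t → ZeroOrEq s (negate t) → s ≡ zer
zeroOrEq-both-signs (inj₁ e) _ = e
zeroOrEq-both-signs (inj₂ refl) (inj₁ e) = e
zeroOrEq-both-signs {neg} (inj₂ refl) (inj₂ ())
zeroOrEq-both-signs {zer} (inj₂ refl) (inj₂ _) = refl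
zeroOrEq-both-signs {pos} (inj₂ refl) (inj₂ ())

zeroOrEq-antisym : ∀ {s y} → ZeroOrEq s y → ZeroOrEq y s → y ≡ s
zeroOrEq-antisym (inj₁ refl) (inj₁ e) = e
zeroOrEq-antisym (inj₁ refl) (inj₂ e) = e
zeroOrEq-antisym (inj₂ e) _ = sym e

rank : ∀ {k} → Vec Sign k → ℕ
rank [] = 0
rank (s ∷ xs) = weight s + rank xs

negV : ∀ {k} → Vec Sign k → Vec Sign k
negV = vmap negate

zeroVec : ∀ {k} → Vec Sign k
zeroVec = replicate _ zer

negV-inv : ∀ {k} (x : Vec Sign k) → negV (negV x) ≡ x
negV-inv [] = refl
negV-inv (s ∷ x) = cong₂ _∷_ (negate-inv s) (negV-inv x)

rank-neg : ∀ {k} (x : Vec Sign k) → rank (negV x) ≡ rank x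
rank-neg [] = refl
rank-neg (s ∷ x) = cong₂ _+_ (weight-neg s) (rank-neg x)

rank-≤ : ∀ {k} (x : Vec Sign k) → rank x ≤ k
rank-≤ [] = z≤n
rank-≤ (zer ∷ x) = m≤n⇒m≤1+n (rank-≤ x)
rank-≤ (neg ∷ x) = s≤s (rank-≤ x)
rank-≤ (pos ∷ x) = s≤s (rank-≤ x)

rank-zeroVec : ∀ {k} → rank (zeroVec {k}) ≡ 0
rank-zeroVec {zero} = refl
rank-zeroVec {suc k} = rank-zeroVec {k}

-- x ⊑ y: x is obtained from y by zeroing some entries (the oriented order,
-- without the global sign ambiguity of ≤P).
data _⊑_ : ∀ {k} → Vec Sign k → Vec Sign k → Set where
  []  : [] ⊑ []
  keep : ∀ {k} s {xs ys : Vec Sign k} → xs ⊑ ys → (s ∷ xs) ⊑ (s ∷ ys)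
  erase : ∀ {k} s {xs ys : Vec Sign k} → xs ⊑ ys → (zer ∷ xs) ⊑ (s ∷ ys)

infix 4 _⊑_

⊑-refl : ∀ {k} (x : Vec Sign k) → x ⊑ x
⊑-refl [] = []
⊑-refl (s ∷ x) = keep s (⊑-refl x)

⊑-tail : ∀ {k s t} {xs ys : Vec Sign k} → (s ∷ xs) ⊑ (t ∷ ys) → xs ⊑ ys
⊑-tail (keep _ p) = p
⊑-tail (erase _ p) = p

⊑-head : ∀ {k s t} {xs ys : Vec Sign k} → (s ∷ xs) ⊑ (t ∷ ys) → ZeroOrEq s t
⊑-head (keep _ p) = inj₂ refl
⊑-head (erase _ p) = inj₁ refl

⊑-cons : ∀ {k s t} {xs ys : Vec Sign k} → ZeroOrEq s t → xs ⊑ ys → (s ∷ xs) ⊑ (t ∷ ys)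
⊑-cons (inj₁ refl) p = erase _ p
⊑-cons (inj₂ refl) p = keep _ p

⊑-trans : ∀ {k} {x y z : Vec Sign k} → x ⊑ y → y ⊑ z → x ⊑ z
⊑-trans [] [] = []
⊑-trans (keep s p) (keep .s q) = keep s (⊑-trans p q)
⊑-trans (keep .zer p) (erase s q) = erase s (⊑-trans p q)
⊑-trans (erase s p) (keep .s q) = erase s (⊑-trans p q)
⊑-trans (erase .zer p) (erase s q) = erase s (⊑-trans p q)

⊑-neg : ∀ {k} {x y : Vec Sign k} → x ⊑ y → negV x ⊑ negV y
⊑-neg [] = []
⊑-neg (keep s p) = keep (negate s) (⊑-neg p)
⊑-neg (erase s p) = erase (negate s) (⊑-neg p)

zeroVec⊑ : ∀ {k} (x : Vec Sign k) → zeroVec ⊑ x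
zeroVec⊑ [] = []
zeroVec⊑ (s ∷ x) = erase s (zeroVec⊑ x)

rank-mono : ∀ {k} {x y : Vec Sign k} → x ⊑ y → rank x ≤ rank y
rank-mono [] = z≤n
rank-mono (keep s p) = +-monoʳ-≤ (weight s) (rank-mono p)
rank-mono (erase s p) = ≤-trans (rank-mono p) (m≤n+m _ (weight s))

⊑∧rank≡⇒≡ : ∀ {k} {x y : Vec Sign k} → x ⊑ y → rank x ≡ rank y → x ≡ y
⊑∧rank≡⇒≡ [] _ = refl
⊑∧rank≡⇒≡ (keep s p) e = cong (s ∷_) (⊑∧rank≡⇒≡ p (+-cancelˡ-≡ (weight s) _ _ e))
⊑∧rank≡⇒≡ (erase zer p) e = cong (zer ∷_) (⊑∧rank≡⇒≡ p e)
⊑∧rank≡⇒≡ (erase neg p) e = ⊥-elim (<⇒≱ (s≤s (rank-mono p)) (≤-reflexive (sym e)))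
⊑∧rank≡⇒≡ (erase pos p) e = ⊥-elim (<⇒≱ (s≤s (rank-mono p)) (≤-reflexive (sym e)))

⊑-both-signs : ∀ {k} {x y : Vec Sign k} → x ⊑ y → x ⊑ negV y → x ≡ zeroVec
⊑-both-signs {x = []} {[]} _ _ = refl
⊑-both-signs {x = s ∷ xs} {t ∷ ys} p q =
  cong₂ _∷_ (zeroOrEq-both-signs (⊑-head p) (⊑-head q)) (⊑-both-signs (⊑-tail p) (⊑-tail q))

-- Sign variation, computed left to right remembering the last nonzero sign
-- (zer at the start).  It is monotone under ⊑ and invariant under negation.

changesFrom : Sign → List Sign → ℕ
changesFrom p [] = 0
changesFrom p (zer ∷ l) = changesFrom p l
changesFrom p (neg ∷ l) = differ p neg + changesFrom neg l
changesFrom p (pos ∷ l) = differ p pos + changesFrom pos l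

variation : ∀ {k} → Vec Sign k → ℕ
variation x = changesFrom zer (toList x)

changes≡changesFrom : ∀ s l → Nonzero s → changes (s ∷ nonzeros l) ≡ changesFrom s l
changes≡changesFrom s [] _ = refl
changes≡changesFrom s (zer ∷ l) h = changes≡changesFrom s l h
changes≡changesFrom s (neg ∷ l) h = cong (differ s neg +_) (changes≡changesFrom neg l (λ ()))
changes≡changesFrom s (pos ∷ l) h = cong (differ s pos +_) (changes≡changesFrom pos l (λ ()))

var≡variation : ∀ {k} (x : Vec Sign k) → var x ≡ variation x
var≡variation x = fromStart (toList x)
  where
  fromStart : ∀ l → changes (nonzeros l) ≡ changesFrom zer l
  fromStart [] = refl
  fromStart (zer ∷ l) = fromStart l
  fromStart (neg ∷ l) = changes≡changesFrom neg l (λ ())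
  fromStart (pos ∷ l) = changes≡changesFrom pos l (λ ())

-- When q is the last sign seen in y and p the last sign seen in x ⊑ y, then
-- p = zer or q ≠ zer; under this invariant a triangle inequality holds.
TrackInv : Sign → Sign → Set
TrackInv p q = p ≡ zer ⊎ Nonzero q

differ-triangle : ∀ p q s → TrackInv p q → Nonzero s → differ p s ≤ differ p q + differ q s
differ-triangle zer q s _ _ = z≤n
differ-triangle neg zer s (inj₁ ()) _
differ-triangle neg zer s (inj₂ h) _ = ⊥-elim (h refl)
differ-triangle pos zer s (inj₁ ()) _
differ-triangle pos zer s (inj₂ h) _ = ⊥-elim (h refl)
differ-triangle neg neg neg _ _ = z≤n
differ-triangle neg neg zer _ h = ⊥-elim (h refl)
differ-triangle neg neg pos _ _ = s≤s z≤n
differ-triangle neg pos neg _ _ = z≤n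
differ-triangle neg pos zer _ h = ⊥-elim (h refl)
differ-triangle neg pos pos _ _ = s≤s z≤n
differ-triangle pos neg neg _ _ = s≤s z≤n
differ-triangle pos neg zer _ h = ⊥-elim (h refl)
differ-triangle pos neg pos _ _ = z≤n
differ-triangle pos pos neg _ _ = s≤s z≤n
differ-triangle pos pos zer _ h = ⊥-elim (h refl)
differ-triangle pos pos pos _ _ = z≤n

changesFrom-mono : ∀ {k} {x y : Vec Sign k} → x ⊑ y → ∀ p q → TrackInv p q →
                   changesFrom p (toList x) ≤ differ p q + changesFrom q (toList y)
changesFrom-mono [] p q _ = z≤n
changesFrom-mono (keep zer d) p q i = changesFrom-mono d p q i
changesFrom-mono (keep neg {xs} {ys} d) p q i = begin
    differ p neg + changesFrom neg (toList xs)
  ≤⟨ +-mono-≤ (differ-triangle p q neg i (λ ())) (changesFrom-mono d neg neg (inj₂ (λ ()))) ⟩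
    (differ p q + differ q neg) + (0 + changesFrom neg (toList ys))
  ≡⟨ +-assoc (differ p q) _ _ ⟩
    differ p q + (differ q neg + changesFrom neg (toList ys)) ∎
  where open ≤-Reasoning
changesFrom-mono (keep pos {xs} {ys} d) p q i = begin
    differ p pos + changesFrom pos (toList xs)
  ≤⟨ +-mono-≤ (differ-triangle p q pos i (λ ())) (changesFrom-mono d pos pos (inj₂ (λ ()))) ⟩
    (differ p q + differ q pos) + (0 + changesFrom pos (toList ys))
  ≡⟨ +-assoc (differ p q) _ _ ⟩
    differ p q + (differ q pos + changesFrom pos (toList ys)) ∎
  where open ≤-Reasoning
changesFrom-mono (erase zer d) p q i = changesFrom-mono d p q i
changesFrom-mono (erase neg {xs} {ys} d) p q i = begin
    changesFrom p (toList xs)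
  ≤⟨ changesFrom-mono d p neg (inj₂ (λ ())) ⟩
    differ p neg + changesFrom neg (toList ys)
  ≤⟨ +-monoˡ-≤ _ (differ-triangle p q neg i (λ ())) ⟩
    (differ p q + differ q neg) + changesFrom neg (toList ys)
  ≡⟨ +-assoc (differ p q) _ _ ⟩
    differ p q + (differ q neg + changesFrom neg (toList ys)) ∎
  where open ≤-Reasoning
changesFrom-mono (erase pos {xs} {ys} d) p q i = begin
    changesFrom p (toList xs)
  ≤⟨ changesFrom-mono d p pos (inj₂ (λ ())) ⟩
    differ p pos + changesFrom pos (toList ys)
  ≤⟨ +-monoˡ-≤ _ (differ-triangle p q pos i (λ ())) ⟩
    (differ p q + differ q pos) + changesFrom pos (toList ys)
  ≡⟨ +-assoc (differ p q) _ _ ⟩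
    differ p q + (differ q pos + changesFrom pos (toList ys)) ∎
  where open ≤-Reasoning

variation-mono : ∀ {k} {x y : Vec Sign k} → x ⊑ y → variation x ≤ variation y
variation-mono d = changesFrom-mono d zer zer (inj₁ refl)

differ-neg : ∀ p s → differ (negate p) (negate s) ≡ differ p s
differ-neg neg neg = refl
differ-neg neg zer = refl
differ-neg neg pos = refl
differ-neg zer s = refl
differ-neg pos neg = refl
differ-neg pos zer = refl
differ-neg pos pos = refl

changesFrom-neg : ∀ {k} p (x : Vec Sign k) →
                  changesFrom (negate p) (toList (negV x)) ≡ changesFrom p (toList x)
changesFrom-neg p [] = refl
changesFrom-neg p (zer ∷ x) = changesFrom-neg p x
changesFrom-neg p (neg ∷ x) = cong₂ _+_ (differ-neg p neg) (changesFrom-neg neg x)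
changesFrom-neg p (pos ∷ x) = cong₂ _+_ (differ-neg p pos) (changesFrom-neg pos x)

variation-neg : ∀ {k} (x : Vec Sign k) → variation (negV x) ≡ variation x
variation-neg x = changesFrom-neg zer x

firstSign : ∀ {k} → Vec Sign k → Sign
firstSign x = firstNonzero (toList x)

firstSign-neg : ∀ {k} (x : Vec Sign k) → firstSign (negV x) ≡ negate (firstSign x)
firstSign-neg [] = refl
firstSign-neg (zer ∷ x) = firstSign-neg x
firstSign-neg (neg ∷ x) = refl
firstSign-neg (pos ∷ x) = refl

firstSign-zer : ∀ {k} (x : Vec Sign k) → firstSign x ≡ zer → rank x ≡ 0
firstSign-zer [] _ = refl
firstSign-zer (zer ∷ x) e = firstSign-zer x e
firstSign-zer (neg ∷ x) ()
firstSign-zer (pos ∷ x) ()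

firstSign-nonzero : ∀ {k} (l : Vec Sign k) → 0 < rank l → Nonzero (firstSign l)
firstSign-nonzero l r e = <⇒≢ r (sym (firstSign-zer l e))

canonical⇒rank>0 : ∀ {k} (x : Vec Sign k) → Canonical x → 0 < rank x
canonical⇒rank>0 [] ()
canonical⇒rank>0 (zer ∷ x) c = canonical⇒rank>0 x c
canonical⇒rank>0 (neg ∷ x) ()
canonical⇒rank>0 (pos ∷ x) c = s≤s z≤n

canonBy : ∀ {k} → Sign → Vec Sign k → Vec Sign k
canonBy neg x = negV x
canonBy zer x = x
canonBy pos x = x

canon : ∀ {k} → Vec Sign k → Vec Sign k
canon x = canonBy (firstSign x) x

canon-canonical : ∀ {k} (x : Vec Sign k) → 0 < rank x → Canonical (canon x)
canon-canonical x r with firstSign x in e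
... | neg = trans (firstSign-neg x) (cong negate e)
... | zer = ⊥-elim (<⇒≢ r (sym (firstSign-zer x e)))
... | pos = e

canon-or : ∀ {k} (x : Vec Sign k) → canon x ≡ x ⊎ canon x ≡ negV x
canon-or x with firstSign x
... | neg = inj₂ refl
... | zer = inj₁ refl
... | pos = inj₁ refl

rank-canon : ∀ {k} (x : Vec Sign k) → rank (canon x) ≡ rank x
rank-canon x with canon-or x
... | inj₁ e = cong rank e
... | inj₂ e = trans (cong rank e) (rank-neg x)

variation-canon : ∀ {k} (x : Vec Sign k) → variation (canon x) ≡ variation x
variation-canon x with canon-or x
... | inj₁ e = cong variation e
... | inj₂ e = trans (cong variation e) (variation-neg x)

canon-rep : ∀ {k} {x y : Vec Sign k} → Canonical x → y ≡ x ⊎ y ≡ negV x → canon y ≡ x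
canon-rep {x = x} c (inj₁ refl) = cong (λ s → canonBy s x) c
canon-rep {x = x} c (inj₂ refl) rewrite firstSign-neg x | c = negV-inv x

-- The order ≤P of the poset P_{n,m} is "x ⊑ y or x ⊑ -y"; we translate
-- between its pointwise formulation and ⊑.

SubPointwise : ∀ {k} → Vec Sign k → Vec Sign k → Set
SubPointwise {k} x y = (i : Fin k) → ZeroOrEq (lookup x i) (lookup y i)

pointwise⇒⊑ : ∀ {k} {x y : Vec Sign k} → SubPointwise x y → x ⊑ y
pointwise⇒⊑ {x = []} {[]} _ = []
pointwise⇒⊑ {x = s ∷ x} {t ∷ y} f = ⊑-cons (f zero) (pointwise⇒⊑ (λ i → f (suc i)))

⊑⇒pointwise : ∀ {k} {x y : Vec Sign k} → x ⊑ y → SubPointwise x y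
⊑⇒pointwise (keep s d) zero = inj₂ refl
⊑⇒pointwise (keep s d) (suc i) = ⊑⇒pointwise d i
⊑⇒pointwise (erase s d) zero = inj₁ refl
⊑⇒pointwise (erase s d) (suc i) = ⊑⇒pointwise d i

SubNegPointwise : ∀ {k} → Vec Sign k → Vec Sign k → Set
SubNegPointwise {k} x y = (i : Fin k) → ZeroOrEq (lookup x i) (negate (lookup y i))

pointwise⇒⊑neg : ∀ {k} {x y : Vec Sign k} → SubNegPointwise x y → x ⊑ negV y
pointwise⇒⊑neg {x = []} {[]} _ = []
pointwise⇒⊑neg {x = s ∷ x} {t ∷ y} f = ⊑-cons (f zero) (pointwise⇒⊑neg (λ i → f (suc i)))

⊑neg⇒pointwise : ∀ {k} {x y : Vec Sign k} → x ⊑ negV y → SubNegPointwise x y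
⊑neg⇒pointwise {x = s ∷ x} {t ∷ y} d zero = ⊑-head d
⊑neg⇒pointwise {x = s ∷ x} {t ∷ y} d (suc i) = ⊑neg⇒pointwise (⊑-tail d) i

-- x ≼ y wraps x ≤P y in a record, so that x and y can be inferred from it.
record _≼_ {k} (x y : Vec Sign k) : Set where
  constructor mk≼
  field un≼ : x ≤P y
open _≼_ public
infix 4 _≼_

≼⇒⊑± : ∀ {k} {x y : Vec Sign k} → x ≼ y → x ⊑ y ⊎ x ⊑ negV y
≼⇒⊑± (mk≼ (inj₁ f)) = inj₁ (pointwise⇒⊑ f)
≼⇒⊑± (mk≼ (inj₂ f)) = inj₂ (pointwise⇒⊑neg f)

⊑⇒≼ : ∀ {k} {x y : Vec Sign k} → x ⊑ y → x ≼ y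
⊑⇒≼ d = mk≼ (inj₁ (⊑⇒pointwise d))

⊑neg⇒≼ : ∀ {k} {x y : Vec Sign k} → x ⊑ negV y → x ≼ y
⊑neg⇒≼ d = mk≼ (inj₂ (⊑neg⇒pointwise d))

⊑neg⇒neg⊑ : ∀ {k} {x y : Vec Sign k} → x ⊑ negV y → negV x ⊑ y
⊑neg⇒neg⊑ {y = y} d = subst (_ ⊑_) (negV-inv y) (⊑-neg d)

⊑⇒⊑negneg : ∀ {k} {x y : Vec Sign k} → x ⊑ y → x ⊑ negV (negV y)
⊑⇒⊑negneg {y = y} d = subst (_ ⊑_) (sym (negV-inv y)) d

≼-refl : ∀ {k} (x : Vec Sign k) → x ≼ x
≼-refl x = ⊑⇒≼ (⊑-refl x)

≼-trans : ∀ {k} {x y z : Vec Sign k} → x ≼ y → y ≼ z → x ≼ z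
≼-trans p q with ≼⇒⊑± p | ≼⇒⊑± q
... | inj₁ a | inj₁ b = ⊑⇒≼ (⊑-trans a b)
... | inj₁ a | inj₂ b = ⊑neg⇒≼ (⊑-trans a b)
... | inj₂ a | inj₁ b = ⊑neg⇒≼ (⊑-trans a (⊑-neg b))
... | inj₂ a | inj₂ b = ⊑⇒≼ (⊑-trans a (⊑neg⇒neg⊑ b))

rank-mono≼ : ∀ {k} {x y : Vec Sign k} → x ≼ y → rank x ≤ rank y
rank-mono≼ {y = y} p with ≼⇒⊑± p
... | inj₁ a = rank-mono a
... | inj₂ a = ≤-trans (rank-mono a) (≤-reflexive (rank-neg y))

zeroVec≼ : ∀ {k} (x : Vec Sign k) → zeroVec ≼ x
zeroVec≼ x = ⊑⇒≼ (zeroVec⊑ x)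

-- On canonical vectors ≼ is antisymmetric: x = -y is impossible when both
-- have first nonzero sign pos.
antisym≼ : ∀ {k} {x y : Vec Sign k} → Canonical x → Canonical y →
           x ≼ y → rank x ≡ rank y → x ≡ y
antisym≼ {x = x} {y = y} cx cy p e with ≼⇒⊑± p
... | inj₁ a = ⊑∧rank≡⇒≡ a e
... | inj₂ a with ⊑∧rank≡⇒≡ a (trans e (sym (rank-neg y)))
... | refl with trans (sym cx) (trans (firstSign-neg y) (cong negate cy))
... | ()

canon≼ : ∀ {k} (y : Vec Sign k) → canon y ≼ y
canon≼ y with canon-or y
... | inj₁ e rewrite e = ≼-refl y
... | inj₂ e rewrite e = ⊑neg⇒≼ (⊑-refl (negV y))

≼canon : ∀ {k} (y : Vec Sign k) → y ≼ canon y
≼canon y with canon-or y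
... | inj₁ e rewrite e = ≼-refl y
... | inj₂ e rewrite e = ⊑neg⇒≼ (⊑⇒⊑negneg (⊑-refl y))

canon-mono : ∀ {k} {x y : Vec Sign k} → x ⊑ y → canon x ≼ canon y
canon-mono {x = x} {y} d = ≼-trans (canon≼ x) (≼-trans (⊑⇒≼ d) (≼canon y))

Comparable : ∀ {k} → Vec Sign k → Vec Sign k → Set
Comparable x y = x ≼ y ⊎ y ≼ x

≤P⇒Comparable : ∀ {k} {x y : Vec Sign k} → (x ≤P y ⊎ y ≤P x) → Comparable x y
≤P⇒Comparable (inj₁ p) = inj₁ (mk≼ p)
≤P⇒Comparable (inj₂ p) = inj₂ (mk≼ p)

Comparable⇒≤P : ∀ {k} {x y : Vec Sign k} → Comparable x y → (x ≤P y ⊎ y ≤P x)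
Comparable⇒≤P (inj₁ p) = inj₁ (un≼ p)
Comparable⇒≤P (inj₂ p) = inj₂ (un≼ p)

Comparable-sym : ∀ {k} {x y : Vec Sign k} → Comparable x y → Comparable y x
Comparable-sym (inj₁ p) = inj₂ p
Comparable-sym (inj₂ p) = inj₁ p

Lt : ∀ {k} → Vec Sign k → Vec Sign k → Set
Lt x y = x ≼ y × rank x < rank y

Lt-trans : ∀ {k} {x y z : Vec Sign k} → Lt x y → Lt y z → Lt x z
Lt-trans (p , r) (q , s) = ≼-trans p q , <-trans r s

Lt⇒Comparable : ∀ {k} {x y : Vec Sign k} → Lt x y → Comparable x y
Lt⇒Comparable (p , _) = inj₁ p

Lt⇒≢ : ∀ {k} {x y : Vec Sign k} → Lt x y → x ≢ y
Lt⇒≢ (_ , r) refl = <-irrefl refl r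

comparable⇒Lt⊎Gt : ∀ {k} {x y : Vec Sign k} → Canonical x → Canonical y →
                   Comparable x y → x ≢ y → Lt x y ⊎ Lt y x
comparable⇒Lt⊎Gt cx cy (inj₁ p) ne with m≤n⇒m<n∨m≡n (rank-mono≼ p)
... | inj₁ r = inj₁ (p , r)
... | inj₂ e = ⊥-elim (ne (antisym≼ cx cy p e))
comparable⇒Lt⊎Gt cx cy (inj₂ p) ne with m≤n⇒m<n∨m≡n (rank-mono≼ p)
... | inj₁ r = inj₂ (p , r)
... | inj₂ e = ⊥-elim (ne (sym (antisym≼ cy cx p e)))

comparable∧rank<⇒Lt : ∀ {k} {x y : Vec Sign k} → Comparable x y → rank x < rank y → Lt x y
comparable∧rank<⇒Lt (inj₁ p) r = p , r
comparable∧rank<⇒Lt (inj₂ p) r = ⊥-elim (<⇒≱ r (rank-mono≼ p))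

-- Choosing signs: from a ⊑ c, y ⊑ c and a ⊑ ±y follows a ⊑ y (the other
-- sign forces a = 0).
orient : ∀ {k} {a c y : Vec Sign k} → a ⊑ c → y ⊑ c → a ⊑ y ⊎ a ⊑ negV y → a ⊑ y
orient ac yc (inj₁ d) = d
orient {a = a} {c} {y} ac yc (inj₂ d) =
  subst (_⊑ y) (sym (⊑-both-signs ac (⊑-trans d (⊑-neg yc)))) (zeroVec⊑ y)

orientBelow : ∀ {k} {x c : Vec Sign k} → x ⊑ c ⊎ x ⊑ negV c →
              Σ (Vec Sign k) λ y → y ⊑ c × (y ≡ x ⊎ y ≡ negV x)
orientBelow {x = x} (inj₁ d) = x , d , inj₁ refl
orientBelow {x = x} (inj₂ d) = negV x , ⊑neg⇒neg⊑ d , inj₂ refl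

orientAbove : ∀ {k} {a x : Vec Sign k} → a ⊑ x ⊎ a ⊑ negV x →
              Σ (Vec Sign k) λ y → a ⊑ y × (y ≡ x ⊎ y ≡ negV x)
orientAbove {x = x} (inj₁ d) = x , d , inj₁ refl
orientAbove {x = x} (inj₂ d) = negV x , d , inj₂ refl

rank-rep : ∀ {k} {x y : Vec Sign k} → y ≡ x ⊎ y ≡ negV x → rank y ≡ rank x
rank-rep (inj₁ refl) = refl
rank-rep {x = x} (inj₂ refl) = rank-neg x

variation-rep : ∀ {k} {x y : Vec Sign k} → y ≡ x ⊎ y ≡ negV x → variation y ≡ variation x
variation-rep (inj₁ refl) = refl
variation-rep {x = x} (inj₂ refl) = variation-neg x

orientBetween : ∀ {k} {a x c : Vec Sign k} → a ≼ x → x ≼ c → a ⊑ c →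
                Σ (Vec Sign k) λ y → a ⊑ y × y ⊑ c × (y ≡ x ⊎ y ≡ negV x)
orientBetween {a = a} {x} {c} ax xc ac with orientBelow {x = x} {c = c} (≼⇒⊑± xc)
... | y , yc , e = y , orient ac yc (flip e (≼⇒⊑± ax)) , yc , e
  where
  flip : y ≡ x ⊎ y ≡ negV x → a ⊑ x ⊎ a ⊑ negV x → a ⊑ y ⊎ a ⊑ negV y
  flip (inj₁ refl) d = d
  flip (inj₂ refl) (inj₁ d) = inj₂ (⊑⇒⊑negneg d)
  flip (inj₂ refl) (inj₂ d) = inj₁ d

stepUp : ∀ {k} {a x : Vec Sign k} → a ⊑ x → rank a < rank x →
         Σ (Vec Sign k) λ α → a ⊑ α × α ⊑ x × rank α ≡ suc (rank a)
stepUp (keep s {xs} {ys} d) r with stepUp d (+-cancelˡ-< (weight s) (rank xs) (rank ys) r)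
... | α , p , q , e = (s ∷ α) , keep s p , keep s q , trans (cong (weight s +_) e) (+-suc (weight s) _)
stepUp (erase zer d) r with stepUp d r
... | α , p , q , e = (zer ∷ α) , keep zer p , keep zer q , e
stepUp (erase neg {xs} d) r = (neg ∷ xs) , erase neg (⊑-refl xs) , keep neg d , refl
stepUp (erase pos {xs} d) r = (pos ∷ xs) , erase pos (⊑-refl xs) , keep pos d , refl

record JoinMeet {k} (x y c : Vec Sign k) : Set where
  field
    J M : Vec Sign k
    xJ : x ⊑ J
    yJ : y ⊑ J
    Jc : J ⊑ c
    Mx : M ⊑ x
    My : M ⊑ y
    glb : ∀ {a} → a ⊑ x → a ⊑ y → a ⊑ M
    rk : rank J + rank M ≡ rank x + rank y

-- The rank bookkeeping of the inductive step of joinMeet.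
+-both : ∀ a b c d e → b + c ≡ d + e → (a + b) + (a + c) ≡ (a + d) + (a + e)
+-both a b c d e h = begin
    (a + b) + (a + c) ≡⟨ solve 3 (λ a b c → (a :+ b) :+ (a :+ c) := (a :+ a) :+ (b :+ c)) refl a b c ⟩
    (a + a) + (b + c) ≡⟨ cong ((a + a) +_) h ⟩
    (a + a) + (d + e) ≡⟨ solve 3 (λ a d e → (a :+ a) :+ (d :+ e) := (a :+ d) :+ (a :+ e)) refl a d e ⟩
    (a + d) + (a + e) ∎
  where open ≡-Reasoning

+-left : ∀ a b c d e → b + c ≡ d + e → (a + b) + c ≡ (a + d) + e
+-left a b c d e h = trans (+-assoc a b c) (trans (cong (a +_) h) (sym (+-assoc a d e)))

+-cross : ∀ a b c d e → b + c ≡ d + e → (a + b) + c ≡ d + (a + e)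
+-cross a b c d e h = begin
    (a + b) + c ≡⟨ +-left a b c d e h ⟩
    (a + d) + e ≡⟨ solve 3 (λ a d e → (a :+ d) :+ e := d :+ (a :+ e)) refl a d e ⟩
    d + (a + e) ∎
  where open ≡-Reasoning

-- Entrywise: J keeps every entry present in x or y, M those present in both.
joinMeet : ∀ {k} {x y c : Vec Sign k} → x ⊑ c → y ⊑ c → JoinMeet x y c
joinMeet [] [] = record { J = [] ; M = [] ; xJ = [] ; yJ = [] ; Jc = [] ; Mx = [] ; My = []
                        ; glb = λ { [] [] → [] } ; rk = refl }
joinMeet (keep s {xs} p) (keep .s {ys} q) = record
  { J = s ∷ J ; M = s ∷ M ; xJ = keep s xJ ; yJ = keep s yJ ; Jc = keep s Jc ; Mx = keep s Mx ; My = keep s My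
  ; glb = λ { {_ ∷ _} d e → ⊑-cons (⊑-head d) (glb (⊑-tail d) (⊑-tail e)) }
  ; rk = +-both (weight s) _ _ (rank xs) (rank ys) rk }
  where open JoinMeet (joinMeet p q)
joinMeet (keep s {xs} p) (erase .s {ys} q) = record
  { J = s ∷ J ; M = zer ∷ M ; xJ = keep s xJ ; yJ = erase s yJ ; Jc = keep s Jc ; Mx = erase s Mx
  ; My = keep zer My
  ; glb = λ { {_ ∷ _} d e → ⊑-cons (⊑-head e) (glb (⊑-tail d) (⊑-tail e)) }
  ; rk = +-left (weight s) _ _ (rank xs) (rank ys) rk }
  where open JoinMeet (joinMeet p q)
joinMeet (erase s {xs} p) (keep .s {ys} q) = record
  { J = s ∷ J ; M = zer ∷ M ; xJ = erase s xJ ; yJ = keep s yJ ; Jc = keep s Jc ; Mx = keep zer Mx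
  ; My = erase s My
  ; glb = λ { {_ ∷ _} d e → ⊑-cons (⊑-head d) (glb (⊑-tail d) (⊑-tail e)) }
  ; rk = +-cross (weight s) _ _ (rank xs) (rank ys) rk }
  where open JoinMeet (joinMeet p q)
joinMeet (erase s {xs} p) (erase .s {ys} q) = record
  { J = zer ∷ J ; M = zer ∷ M ; xJ = keep zer xJ ; yJ = keep zer yJ ; Jc = erase s Jc ; Mx = keep zer Mx
  ; My = keep zer My
  ; glb = λ { {_ ∷ _} d e → ⊑-cons (⊑-head d) (glb (⊑-tail d) (⊑-tail e)) }
  ; rk = rk }
  where open JoinMeet (joinMeet p q)

-- Started from the first sign of l, it is a full
-- vector above l with the same first sign and the same variation.

fill : ∀ {k} → Sign → Vec Sign k → Vec Sign k
fill p [] = []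
fill p (zer ∷ l) = p ∷ fill p l
fill p (neg ∷ l) = neg ∷ fill neg l
fill p (pos ∷ l) = pos ∷ fill pos l

fill-sub : ∀ {k} p (l : Vec Sign k) → l ⊑ fill p l
fill-sub p [] = []
fill-sub p (zer ∷ l) = erase p (fill-sub p l)
fill-sub p (neg ∷ l) = keep neg (fill-sub neg l)
fill-sub p (pos ∷ l) = keep pos (fill-sub pos l)

fill-full : ∀ {k} p (l : Vec Sign k) → Nonzero p → rank (fill p l) ≡ k
fill-full p [] h = refl
fill-full p (zer ∷ l) h = cong₂ _+_ (weight-nonzero p h) (fill-full p l h)
fill-full p (neg ∷ l) h = cong suc (fill-full neg l (λ ()))
fill-full p (pos ∷ l) h = cong suc (fill-full pos l (λ ()))

fill-nonzero : ∀ {k} p (l : Vec Sign k) → Nonzero p → (i : Fin k) → Nonzero (lookup (fill p l) i)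
fill-nonzero p (zer ∷ l) h zero = h
fill-nonzero p (neg ∷ l) h zero = λ ()
fill-nonzero p (pos ∷ l) h zero = λ ()
fill-nonzero p (zer ∷ l) h (suc i) = fill-nonzero p l h i
fill-nonzero p (neg ∷ l) h (suc i) = fill-nonzero neg l (λ ()) i
fill-nonzero p (pos ∷ l) h (suc i) = fill-nonzero pos l (λ ()) i

firstSign-fill : ∀ {k} p (l : Vec Sign k) → firstSign l ≡ p → Nonzero p → firstSign (fill p l) ≡ p
firstSign-fill neg (zer ∷ l) e h = refl
firstSign-fill zer l e h = ⊥-elim (h refl)
firstSign-fill pos (zer ∷ l) e h = refl
firstSign-fill p [] e h = ⊥-elim (h (sym e))
firstSign-fill .neg (neg ∷ l) refl h = refl
firstSign-fill .pos (pos ∷ l) refl h = refl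

changesFrom-repeat : ∀ p X → Nonzero p → changesFrom p (p ∷ X) ≡ changesFrom p X
changesFrom-repeat neg X _ = refl
changesFrom-repeat zer X h = ⊥-elim (h refl)
changesFrom-repeat pos X _ = refl

changesFrom-nonzero : ∀ p y X → Nonzero y → changesFrom p (y ∷ X) ≡ differ p y + changesFrom y X
changesFrom-nonzero p neg X _ = refl
changesFrom-nonzero p zer X h = ⊥-elim (h refl)
changesFrom-nonzero p pos X _ = refl

changesFrom-cong : ∀ p y {X Y} → Nonzero y → changesFrom y X ≡ changesFrom y Y →
                   changesFrom p (y ∷ X) ≡ changesFrom p (y ∷ Y)
changesFrom-cong p y {X} {Y} hy e = begin
    changesFrom p (y ∷ X)          ≡⟨ changesFrom-nonzero p y X hy ⟩
    differ p y + changesFrom y X   ≡⟨ cong (differ p y +_) e ⟩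
    differ p y + changesFrom y Y   ≡⟨ sym (changesFrom-nonzero p y Y hy) ⟩
    changesFrom p (y ∷ Y)          ∎
  where open ≡-Reasoning

changesFrom-fill-same : ∀ {k} p (l : Vec Sign k) → Nonzero p →
                        changesFrom p (toList (fill p l)) ≡ changesFrom p (toList l)
changesFrom-fill-same p [] h = refl
changesFrom-fill-same p (zer ∷ l) h = trans (changesFrom-repeat p _ h) (changesFrom-fill-same p l h)
changesFrom-fill-same p (neg ∷ l) h = cong (differ p neg +_) (changesFrom-fill-same neg l (λ ()))
changesFrom-fill-same p (pos ∷ l) h = cong (differ p pos +_) (changesFrom-fill-same pos l (λ ()))

changesFrom-first : ∀ {k} y p (l : Vec Sign k) → firstSign l ≡ p → Nonzero p →
                    changesFrom y (toList l) ≡ differ y p + changesFrom p (toList l)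
changesFrom-first y p [] e h = ⊥-elim (h (sym e))
changesFrom-first y p (zer ∷ l) e h = changesFrom-first y p l e h
changesFrom-first y .neg (neg ∷ l) refl h = refl
changesFrom-first y .pos (pos ∷ l) refl h = refl

changesFrom-fill : ∀ {k} y p (l : Vec Sign k) → firstSign l ≡ p → Nonzero p →
                   changesFrom y (toList (fill p l)) ≡ changesFrom y (toList l)
changesFrom-fill y p l e h = begin
    changesFrom y (toList (fill p l))       ≡⟨ changesFrom-first y p (fill p l) (firstSign-fill p l e h) h ⟩
    differ y p + changesFrom p (toList (fill p l)) ≡⟨ cong (differ y p +_) (changesFrom-fill-same p l h) ⟩
    differ y p + changesFrom p (toList l)   ≡⟨ sym (changesFrom-first y p l e h) ⟩
    changesFrom y (toList l)                ∎
  where open ≡-Reasoning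

variation-fill : ∀ {k} (l : Vec Sign k) → 0 < rank l → variation (fill (firstSign l) l) ≡ variation l
variation-fill l r = changesFrom-fill zer (firstSign l) l refl (firstSign-nonzero l r)

rank-update : ∀ {k} (a : Vec Sign k) i y → lookup a i ≡ zer → rank (a [ i ]≔ y) ≡ weight y + rank a
rank-update (.zer ∷ a) zero y refl = refl
rank-update (s ∷ a) (suc i) y e = begin
    weight s + rank (a [ i ]≔ y)  ≡⟨ cong (weight s +_) (rank-update a i y e) ⟩
    weight s + (weight y + rank a)
      ≡⟨ solve 3 (λ s y r → s :+ (y :+ r) := y :+ (s :+ r)) refl (weight s) (weight y) (rank a) ⟩
    weight y + (weight s + rank a) ∎
  where open ≡-Reasoning

update-above : ∀ {k} (a : Vec Sign k) i y → lookup a i ≡ zer → a ⊑ a [ i ]≔ y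
update-above (.zer ∷ a) zero y refl = erase y (⊑-refl a)
update-above (s ∷ a) (suc i) y e = keep s (update-above a i y e)

update-below : ∀ {k} {a x : Vec Sign k} (i : Fin k) {y} → a ⊑ x → lookup x i ≡ y → a [ i ]≔ y ⊑ x
update-below zero (keep s d) refl = keep s d
update-below zero (erase s d) refl = keep s d
update-below (suc i) (keep s d) e = keep s (update-below i d e)
update-below (suc i) (erase s d) e = erase s (update-below i d e)

update-⊑-update : ∀ {k} {a u : Vec Sign k} (i j : Fin k) (t y : Sign) →
                  a ⊑ u → lookup a i ≡ zer ⊎ i ≡ j → ZeroOrEq t (lookup u j) ⊎ i ≡ j →
                  (i ≡ j → ZeroOrEq t y) → a [ j ]≔ t ⊑ u [ i ]≔ y
update-⊑-update {a = a} {u} i j t y d ai tu ty = pointwise⇒⊑ entry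
  where
  other : ∀ (v : Vec Sign _) {p r} s → r ≢ p → lookup (v [ p ]≔ s) r ≡ lookup v r
  other v s ne = VP.lookup∘update′ ne v s
  entry : SubPointwise (a [ j ]≔ t) (u [ i ]≔ y)
  entry r with r FP.≟ j | r FP.≟ i
  ... | yes refl | yes refl rewrite VP.lookup∘update r a t | VP.lookup∘update r u y = ty refl
  ... | yes refl | no r≢i rewrite VP.lookup∘update r a t | other u y r≢i = tu′ tu
    where tu′ : ZeroOrEq t (lookup u r) ⊎ i ≡ r → ZeroOrEq t (lookup u r)
          tu′ (inj₁ s) = s
          tu′ (inj₂ e) = ⊥-elim (r≢i (sym e))
  ... | no r≢j | yes refl rewrite other a t r≢j | VP.lookup∘update r u y = ai′ ai
    where ai′ : lookup a r ≡ zer ⊎ r ≡ j → ZeroOrEq (lookup a r) y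
          ai′ (inj₁ z) = inj₁ z
          ai′ (inj₂ e) = ⊥-elim (r≢j e)
  ... | no r≢j | no r≢i rewrite other a t r≢j | other u y r≢i = ⊑⇒pointwise d r

-- A zero slot of a whose filling costs no more variation in the fill of a
-- than in a itself: the last zero of the first block of zeros after the
-- first nonzero entry (or the first entry, if a starts with zer).

freeSlotFrom : ∀ {k} (l : Vec Sign k) → rank l < k → Fin k
freeSlotFrom (zer ∷ []) _ = zero
freeSlotFrom (zer ∷ zer ∷ l) _ = suc (freeSlotFrom (zer ∷ l) (s≤s (rank-≤ l)))
freeSlotFrom (zer ∷ neg ∷ l) _ = zero
freeSlotFrom (zer ∷ pos ∷ l) _ = zero
freeSlotFrom (neg ∷ l) (s≤s h) = suc (freeSlotFrom l h)
freeSlotFrom (pos ∷ l) (s≤s h) = suc (freeSlotFrom l h)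

FreeSlot : ∀ {k} → Sign → Vec Sign k → Fin k → Set
FreeSlot p l i = lookup l i ≡ zer ×
  (∀ y → Nonzero y → changesFrom p (toList (fill p l [ i ]≔ y)) ≤ changesFrom p (toList (l [ i ]≔ y)))

freeSlotFrom-spec : ∀ {k} p (l : Vec Sign k) (h : rank l < k) → Nonzero p → FreeSlot p l (freeSlotFrom l h)
freeSlotFrom-spec p (zer ∷ []) _ hp = refl , λ y _ → ≤-refl
freeSlotFrom-spec p (zer ∷ zer ∷ l) _ hp with freeSlotFrom-spec p (zer ∷ l) (s≤s (rank-≤ l)) hp
... | z , f = z , λ y hy → ≤-trans (≤-reflexive (changesFrom-repeat p _ hp)) (f y hy)
freeSlotFrom-spec p (zer ∷ neg ∷ l) _ hp =
  refl , λ y hy → ≤-reflexive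
    (changesFrom-cong p y hy (cong (differ y neg +_) (changesFrom-fill-same neg l (λ ()))))
freeSlotFrom-spec p (zer ∷ pos ∷ l) _ hp =
  refl , λ y hy → ≤-reflexive
    (changesFrom-cong p y hy (cong (differ y pos +_) (changesFrom-fill-same pos l (λ ()))))
freeSlotFrom-spec p (neg ∷ l) (s≤s h) hp with freeSlotFrom-spec neg l h (λ ())
... | z , f = z , λ y hy → +-monoʳ-≤ (differ p neg) (f y hy)
freeSlotFrom-spec p (pos ∷ l) (s≤s h) hp with freeSlotFrom-spec pos l h (λ ())
... | z , f = z , λ y hy → +-monoʳ-≤ (differ p pos) (f y hy)

freeSlot : ∀ {k} (a : Vec Sign k) → rank a < k → Fin k
freeSlot (zer ∷ l) _ = zero
freeSlot (neg ∷ l) (s≤s h) = suc (freeSlotFrom l h)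
freeSlot (pos ∷ l) (s≤s h) = suc (freeSlotFrom l h)

freeSlot-spec : ∀ {k} (a : Vec Sign k) (h : rank a < k) → 0 < rank a →
                lookup a (freeSlot a h) ≡ zer ×
                (∀ y → Nonzero y → variation (fill (firstSign a) a [ freeSlot a h ]≔ y)
                                    ≤ variation (a [ freeSlot a h ]≔ y))
freeSlot-spec (zer ∷ l) h r = refl , λ y hy → ≤-reflexive (begin
    changesFrom zer (y ∷ toList (fill (firstSign l) l)) ≡⟨ changesFrom-nonzero zer y _ hy ⟩
    changesFrom y (toList (fill (firstSign l) l))
      ≡⟨ changesFrom-fill y (firstSign l) l refl (firstSign-nonzero l r) ⟩
    changesFrom y (toList l)                            ≡⟨ sym (changesFrom-nonzero zer y _ hy) ⟩
    changesFrom zer (y ∷ toList l)                      ∎)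
  where open ≡-Reasoning
freeSlot-spec (neg ∷ l) (s≤s h) r = freeSlotFrom-spec neg l h (λ ())
freeSlot-spec (pos ∷ l) (s≤s h) r = freeSlotFrom-spec pos l h (λ ())

someZero : ∀ {k} (a : Vec Sign k) → rank a < k → Σ (Fin k) λ j → lookup a j ≡ zer
someZero (zer ∷ a) _ = zero , refl
someZero (neg ∷ a) (s≤s h) with someZero a h
... | j , e = suc j , e
someZero (pos ∷ a) (s≤s h) with someZero a h
... | j , e = suc j , e

otherZero : ∀ {k} (a : Vec Sign k) (i : Fin k) → suc (suc (rank a)) ≤ k →
            Σ (Fin k) λ j → j ≢ i × lookup a j ≡ zer
otherZero (s ∷ a) zero (s≤s h) with someZero a (≤-trans (s≤s (m≤n+m (rank a) (weight s))) h)
... | j , e = suc j , (λ ()) , e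
otherZero (zer ∷ a) (suc i) h = zero , (λ ()) , refl
otherZero (neg ∷ a) (suc i) (s≤s h) with otherZero a i h
... | j , ne , e = suc j , (λ q → ne (FP.suc-injective q)) , e
otherZero (pos ∷ a) (suc i) (s≤s h) with otherZero a i h
... | j , ne , e = suc j , (λ q → ne (FP.suc-injective q)) , e

-- Intervals of length two are diamonds: they contain at most two elements
-- of middle rank.  Likewise a vector with one zero has at most two full
-- vectors above it.  Both say: among three candidates, two coincide.

SomeTwoEqual : ∀ {A : Set} → A → A → A → Set
SomeTwoEqual y1 y2 y3 = y1 ≡ y2 ⊎ y1 ≡ y3 ⊎ y2 ≡ y3

pigeonhole3 : ∀ {A : Set} {P Q y1 y2 y3 : A} → (y1 ≡ P ⊎ y1 ≡ Q) → (y2 ≡ P ⊎ y2 ≡ Q) →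
              (y3 ≡ P ⊎ y3 ≡ Q) → SomeTwoEqual y1 y2 y3
pigeonhole3 (inj₁ a) (inj₁ b) _ = inj₁ (trans a (sym b))
pigeonhole3 (inj₂ a) (inj₂ b) _ = inj₁ (trans a (sym b))
pigeonhole3 (inj₁ a) (inj₂ b) (inj₁ c) = inj₂ (inj₁ (trans a (sym c)))
pigeonhole3 (inj₁ a) (inj₂ b) (inj₂ c) = inj₂ (inj₂ (trans b (sym c)))
pigeonhole3 (inj₂ a) (inj₁ b) (inj₁ c) = inj₂ (inj₂ (trans b (sym c)))
pigeonhole3 (inj₂ a) (inj₁ b) (inj₂ c) = inj₂ (inj₁ (trans a (sym c)))

SomeTwoEqual-cons : ∀ {k} s {y1 y2 y3 : Vec Sign k} →
                    SomeTwoEqual y1 y2 y3 → SomeTwoEqual (s ∷ y1) (s ∷ y2) (s ∷ y3)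
SomeTwoEqual-cons s (inj₁ e) = inj₁ (cong (s ∷_) e)
SomeTwoEqual-cons s (inj₂ (inj₁ e)) = inj₂ (inj₁ (cong (s ∷_) e))
SomeTwoEqual-cons s (inj₂ (inj₂ e)) = inj₂ (inj₂ (cong (s ∷_) e))

Middle : ∀ {k} → Vec Sign k → Vec Sign k → Vec Sign k → Set
Middle a c y = a ⊑ y × y ⊑ c × rank y ≡ suc (rank a)

middle-keep : ∀ {k} s {a c : Vec Sign k} {y} → Middle (s ∷ a) (s ∷ c) y →
              Σ (Vec Sign k) λ y′ → y ≡ s ∷ y′ × Middle a c y′
middle-keep s {a} {y = y0 ∷ y} (p , q , r) with zeroOrEq-antisym (⊑-head p) (⊑-head q)
... | refl = y , refl , ⊑-tail p , ⊑-tail q ,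
             +-cancelˡ-≡ (weight s) _ _ (trans r (sym (+-suc (weight s) (rank a))))

middle-erase : ∀ {k} t {a c : Vec Sign k} {y} → Nonzero t → rank (t ∷ c) ≡ suc (suc (rank a)) →
               Middle (zer ∷ a) (t ∷ c) y → y ≡ zer ∷ c ⊎ y ≡ t ∷ a
middle-erase t {a} {c} {y0 ∷ y} ht rc (p , q , r) with ⊑-head q
... | inj₁ refl = inj₁ (cong (zer ∷_) (⊑∧rank≡⇒≡ (⊑-tail q) (trans r (sym rc′))))
  where
  rc′ : rank c ≡ suc (rank a)
  rc′ = suc-injective (trans (cong (_+ rank c) (sym (weight-nonzero t ht))) rc)
... | inj₂ refl = inj₂ (cong (t ∷_) (sym (⊑∧rank≡⇒≡ (⊑-tail p) ry)))
  where
  ry : rank a ≡ rank y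
  ry = sym (suc-injective (trans (cong (_+ rank y) (sym (weight-nonzero t ht))) r))

diamond : ∀ {k} {a c y1 y2 y3 : Vec Sign k} → a ⊑ c → rank c ≡ suc (suc (rank a)) →
          Middle a c y1 → Middle a c y2 → Middle a c y3 → SomeTwoEqual y1 y2 y3
diamond [] ()
diamond {a = _ ∷ a} {_ ∷ c} (keep s ac) rc m1 m2 m3
  with middle-keep s m1 | middle-keep s m2 | middle-keep s m3
... | _ , refl , m1′ | _ , refl , m2′ | _ , refl , m3′ =
  SomeTwoEqual-cons s (diamond ac rc′ m1′ m2′ m3′)
  where
  rc′ : rank c ≡ suc (suc (rank a))
  rc′ = +-cancelˡ-≡ (weight s) _ _
          (trans rc (sym (trans (+-suc (weight s) (suc (rank a))) (cong suc (+-suc (weight s) (rank a))))))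
diamond (erase zer ac) rc m1 m2 m3
  with middle-keep zer m1 | middle-keep zer m2 | middle-keep zer m3
... | _ , refl , m1′ | _ , refl , m2′ | _ , refl , m3′ = SomeTwoEqual-cons zer (diamond ac rc m1′ m2′ m3′)
diamond (erase neg ac) rc m1 m2 m3 =
  pigeonhole3 (middle-erase neg (λ ()) rc m1) (middle-erase neg (λ ()) rc m2) (middle-erase neg (λ ()) rc m3)
diamond (erase pos ac) rc m1 m2 m3 =
  pigeonhole3 (middle-erase pos (λ ()) rc m1) (middle-erase pos (λ ()) rc m2) (middle-erase pos (λ ()) rc m3)

FullAbove : ∀ {k} → Vec Sign k → Vec Sign k → Set
FullAbove {k} a y = a ⊑ y × rank y ≡ k

fullAbove-zer : ∀ {k} {a : Vec Sign k} {y} → rank a ≡ k → FullAbove (zer ∷ a) y →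
                y ≡ neg ∷ a ⊎ y ≡ pos ∷ a
fullAbove-zer {k} {a} {y0 ∷ y} ra (p , r)
  with ⊑∧rank≡⇒≡ (⊑-tail p) (≤-antisym (rank-mono (⊑-tail p)) (subst (rank y ≤_) (sym ra) (rank-≤ y)))
fullAbove-zer {y = neg ∷ _} ra (p , r) | refl = inj₁ refl
fullAbove-zer {y = pos ∷ _} ra (p , r) | refl = inj₂ refl
fullAbove-zer {y = zer ∷ _} ra (p , r) | refl = ⊥-elim (1+n≢n (sym (trans (sym ra) r)))

fullAbove-keep : ∀ {k} {s} {a : Vec Sign k} {y} → Nonzero s → FullAbove (s ∷ a) y →
                 Σ (Vec Sign k) λ y′ → y ≡ s ∷ y′ × FullAbove a y′
fullAbove-keep {s = s} {y = y0 ∷ y} hs (p , r) with ⊑-head p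
... | inj₁ z = ⊥-elim (hs z)
... | inj₂ refl = y , refl , ⊑-tail p , suc-injective (trans (cong (_+ rank y) (sym (weight-nonzero s hs))) r)

topCovers-keep : ∀ {k} {s} {a : Vec Sign k} {y1 y2 y3} → Nonzero s → suc (rank (s ∷ a)) ≡ suc k →
                 FullAbove (s ∷ a) y1 → FullAbove (s ∷ a) y2 → FullAbove (s ∷ a) y3 →
                 SomeTwoEqual y1 y2 y3

topCovers : ∀ {k} {a y1 y2 y3 : Vec Sign k} → suc (rank a) ≡ k →
            FullAbove a y1 → FullAbove a y2 → FullAbove a y3 → SomeTwoEqual y1 y2 y3
topCovers {a = []} ()
topCovers {suc k} {a = zer ∷ a} ra f1 f2 f3 =
  pigeonhole3 (fullAbove-zer ra′ f1) (fullAbove-zer ra′ f2) (fullAbove-zer ra′ f3)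
  where
  ra′ : rank a ≡ k
  ra′ = suc-injective ra
topCovers {a = neg ∷ a} ra f1 f2 f3 = topCovers-keep (λ ()) ra f1 f2 f3
topCovers {a = pos ∷ a} ra f1 f2 f3 = topCovers-keep (λ ()) ra f1 f2 f3

topCovers-keep {k} {s = s} {a} hs ra f1 f2 f3 with fullAbove-keep hs f1 | fullAbove-keep hs f2 | fullAbove-keep hs f3
... | _ , refl , g1 | _ , refl , g2 | _ , refl , g3 = SomeTwoEqual-cons s (topCovers ra′ g1 g2 g3)
  where
  ra′ : suc (rank a) ≡ k
  ra′ = trans (cong (_+ rank a) (sym (weight-nonzero s hs))) (suc-injective ra)

record OrientedTop {k} (lo x : Vec Sign k) : Set where
  constructor mkOrientedTop
  field
    c : Vec Sign k
    loc : lo ⊑ c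
    vrc : variation c ≡ variation x
    rkc : rank c ≡ rank x
    cx : c ≼ x
    xc : x ≼ c

orientedTop : ∀ {k} {lo x : Vec Sign k} → lo ≼ x → OrientedTop lo x
orientedTop {x = x} p with ≼⇒⊑± p
... | inj₁ d = mkOrientedTop x d refl refl (≼-refl x) (≼-refl x)
... | inj₂ d = mkOrientedTop (negV x) d (variation-neg x) (rank-neg x) (⊑neg⇒≼ (⊑-refl (negV x)))
                 (⊑neg⇒≼ (⊑⇒⊑negneg (⊑-refl x)))

canon-rep-≡ : ∀ {k} {x x′ y y′ : Vec Sign k} → Canonical x → Canonical x′ →
              y ≡ x ⊎ y ≡ negV x → y′ ≡ x′ ⊎ y′ ≡ negV x′ → y ≡ y′ → x ≡ x′
canon-rep-≡ c c′ e e′ q = trans (sym (canon-rep c e)) (trans (cong canon q) (canon-rep c′ e′))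

SomeTwoEqual-canon : ∀ {k} {x1 x2 x3 y1 y2 y3 : Vec Sign k} → Canonical x1 → Canonical x2 → Canonical x3 →
                     y1 ≡ x1 ⊎ y1 ≡ negV x1 → y2 ≡ x2 ⊎ y2 ≡ negV x2 → y3 ≡ x3 ⊎ y3 ≡ negV x3 →
                     SomeTwoEqual y1 y2 y3 → SomeTwoEqual x1 x2 x3
SomeTwoEqual-canon c1 c2 c3 e1 e2 e3 (inj₁ q) = inj₁ (canon-rep-≡ c1 c2 e1 e2 q)
SomeTwoEqual-canon c1 c2 c3 e1 e2 e3 (inj₂ (inj₁ q)) = inj₂ (inj₁ (canon-rep-≡ c1 c3 e1 e3 q))
SomeTwoEqual-canon c1 c2 c3 e1 e2 e3 (inj₂ (inj₂ q)) = inj₂ (inj₂ (canon-rep-≡ c2 c3 e2 e3 q))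

-- The diamond property for ≼ on canonical vectors: orient everything below
-- an orientation of the top b, then apply diamond.
MiddleV : ∀ {k} → Vec Sign k → Vec Sign k → Vec Sign k → Set
MiddleV a b x = a ≼ x × x ≼ b × rank x ≡ suc (rank a)

orientMiddle : ∀ {k} {a b x : Vec Sign k} (o : OrientedTop a b) → MiddleV a b x →
               Σ (Vec Sign k) λ y → Middle a (OrientedTop.c o) y × (y ≡ x ⊎ y ≡ negV x)
orientMiddle o (ax , xb , rx) with orientBetween ax (≼-trans xb (OrientedTop.xc o)) (OrientedTop.loc o)
... | y , ay , yc , e = y , (ay , yc , trans (rank-rep e) rx) , e

diamond-canonical : ∀ {k} {a b x1 x2 x3 : Vec Sign k} → Canonical x1 → Canonical x2 → Canonical x3 →
                    a ≼ b → rank b ≡ suc (suc (rank a)) →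
                    MiddleV a b x1 → MiddleV a b x2 → MiddleV a b x3 → SomeTwoEqual x1 x2 x3
diamond-canonical c1 c2 c3 ab rb m1 m2 m3
  with orientMiddle (orientedTop ab) m1 | orientMiddle (orientedTop ab) m2 | orientMiddle (orientedTop ab) m3
... | _ , n1 , e1 | _ , n2 , e2 | _ , n3 , e3 =
  SomeTwoEqual-canon c1 c2 c3 e1 e2 e3 (diamond loc (trans rkc rb) n1 n2 n3)
  where open OrientedTop (orientedTop ab)

topCovers-canonical : ∀ {k} {a x1 x2 x3 : Vec Sign k} → Canonical x1 → Canonical x2 → Canonical x3 →
                      suc (rank a) ≡ k → a ≼ x1 → a ≼ x2 → a ≼ x3 →
                      rank x1 ≡ k → rank x2 ≡ k → rank x3 ≡ k → SomeTwoEqual x1 x2 x3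
topCovers-canonical {a = a} c1 c2 c3 ra a1 a2 a3 r1 r2 r3
  with orientAbove (≼⇒⊑± a1) | orientAbove (≼⇒⊑± a2) | orientAbove (≼⇒⊑± a3)
... | y1 , p1 , e1 | y2 , p2 , e2 | y3 , p3 , e3 =
  SomeTwoEqual-canon c1 c2 c3 e1 e2 e3
    (topCovers ra (p1 , trans (rank-rep e1) r1) (p2 , trans (rank-rep e2) r2) (p3 , trans (rank-rep e3) r3))

-- Arithmetic of chain lengths: a chain of ℓ vertices above rank a, ending
-- below rank c, forces its first vertex down to rank a + 1 when c = ℓ + 1 + a.
squeeze : ∀ ℓ {a b c} → ℓ + b ≤ c → suc ℓ + a ≡ c → a < b → b ≡ suc a
squeeze ℓ {a} h e lt =
  ≤-antisym (+-cancelˡ-≤ ℓ _ _ (≤-trans h (≤-reflexive (trans (sym e) (sym (+-suc ℓ a)))))) lt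

<-skip : ∀ {a r} → a < r → r ≢ suc a → suc a < r
<-skip p ne = ≤∧≢⇒< p (λ z → ne (sym z))

shift : ∀ ℓ {a b c} → b ≡ suc a → suc ℓ + a ≡ c → ℓ + b ≡ c
shift ℓ {a} eb e = trans (cong (ℓ +_) eb) (trans (+-suc ℓ a) e)

-- Chains of P_{n,m}.  A chain is sorted between a lower bound lo (the zero
-- vector or a vertex) and an optional upper bound hi (nothing standing for a
-- virtual top of rank n + 1).
module Chains (n m : ℕ) where

  V : Set
  V = Vec Sign n

  Face : List V → Set
  Face = OrderComplexFace n m

  mkInP : (x : V) → 0 < rank x → variation x ≤ m → InP n m (canon x)
  mkInP x r v = canon-canonical x r , subst (_≤ m) (sym (trans (var≡variation (canon x)) (variation-canon x))) v

  InP-variation : ∀ {x : V} → InP n m x → variation x ≤ m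
  InP-variation {x} (_ , v) = subst (_≤ m) (var≡variation x) v

  rankH : Maybe V → ℕ
  rankH nothing = suc n
  rankH (just b) = rank b

  BelowH : V → Maybe V → Set
  BelowH x nothing = ⊤
  BelowH x (just b) = x ≼ b

  AboveH : Maybe V → V → Set
  AboveH nothing y = ⊥
  AboveH (just b) y = b ≼ y

  BelowH-trans : ∀ {x y : V} hi → x ≼ y → BelowH y hi → BelowH x hi
  BelowH-trans nothing _ _ = tt
  BelowH-trans (just b) p q = ≼-trans p q

  InGap : V → Maybe V → V → Set
  InGap lo hi v = Lt lo v × BelowH v hi × rank v < rankH hi

  data Chain (lo : V) (hi : Maybe V) : List V → Set where
    nil : BelowH lo hi → rank lo < rankH hi → Chain lo hi []
    cons : ∀ {x L} → Lt lo x → Chain x hi L → Chain lo hi (x ∷ L)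

  Chain-top : ∀ {lo hi L} → Chain lo hi L → BelowH lo hi × rank lo < rankH hi
  Chain-top (nil b r) = b , r
  Chain-top {hi = hi} (cons (p , r) s) with Chain-top s
  ... | b , r' = BelowH-trans hi p b , <-trans r r'

  Chain-mem : ∀ {lo hi L x} → Chain lo hi L → x ∈ L → InGap lo hi x
  Chain-mem (cons l s) (here refl) = l , Chain-top s
  Chain-mem (cons l s) (there i) with Chain-mem s i
  ... | l' , b = Lt-trans l l' , b

  Chain-count : ∀ {lo hi L} → Chain lo hi L → suc (length L) + rank lo ≤ rankH hi
  Chain-count (nil _ r) = r
  Chain-count {lo} {L = x ∷ L} (cons (_ , r) s) =
    ≤-trans (≤-reflexive (sym (+-suc (suc (length L)) (rank lo))))
            (≤-trans (+-monoʳ-≤ (suc (length L)) r) (Chain-count s))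

  Chain-unique : ∀ {lo hi L} → Chain lo hi L → Unique L
  Chain-unique (nil _ _) = []
  Chain-unique (cons _ s) = All.tabulate (λ i → Lt⇒≢ (proj₁ (Chain-mem s i))) ∷ Chain-unique s

  Chain-comparable : ∀ {lo hi L x y} → Chain lo hi L → x ∈ L → y ∈ L → Comparable x y
  Chain-comparable (cons _ s) (here refl) (here refl) = inj₁ (≼-refl _)
  Chain-comparable (cons _ s) (here refl) (there j) = Lt⇒Comparable (proj₁ (Chain-mem s j))
  Chain-comparable (cons _ s) (there i) (here refl) = Comparable-sym (Lt⇒Comparable (proj₁ (Chain-mem s i)))
  Chain-comparable (cons _ s) (there i) (there j) = Chain-comparable s i j

  faceAll : ∀ {F} → Face F → All (InP n m) F
  faceAll (_ , _ , ps , _) = ps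

  faceIn : ∀ {F x} → Face F → x ∈ F → InP n m x
  faceIn f i = All.lookup (faceAll f) i

  faceCmp : ∀ {F x y} → Face F → x ∈ F → y ∈ F → Comparable x y
  faceCmp (_ , _ , _ , cm) i j = ≤P⇒Comparable (cm i j)

  faceCons : ∀ {F v} → Face F → InP n m v → v ∉ F → (∀ {y} → y ∈ F → Comparable y v) →
             Face (v ∷ F)
  faceCons {F} {v} (ne , u , ps , cm) pv nv cv = (λ ()) , (All.tabulate fresh ∷ u) , (pv ∷ ps) , c
    where
    fresh : ∀ {y} → y ∈ F → v ≢ y
    fresh i refl = nv i
    c : ∀ {x y} → x ∈ v ∷ F → y ∈ v ∷ F → x ≤P y ⊎ y ≤P x
    c (here refl) (here refl) = inj₁ (un≼ (≼-refl v))
    c (here refl) (there j) = Comparable⇒≤P (Comparable-sym (cv j))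
    c (there i) (here refl) = Comparable⇒≤P (cv i)
    c (there i) (there j) = cm i j

  sameRank : ∀ {G x y} → Face G → x ∈ G → y ∈ G → rank x ≡ rank y → x ≡ y
  sameRank f i j e with faceCmp f i j
  ... | inj₁ p = antisym≼ (proj₁ (faceIn f i)) (proj₁ (faceIn f j)) p e
  ... | inj₂ p = sym (antisym≼ (proj₁ (faceIn f j)) (proj₁ (faceIn f i)) p (sym e))

  record Insertion (lo : V) (hi : Maybe V) (x : V) (L : List V) : Set where
    field
      L' : List V
      sc : Chain lo hi L'
      xin : x ∈ L'
      sub : ∀ {z} → z ∈ L → z ∈ L'
      sup : ∀ {z} → z ∈ L' → z ≡ x ⊎ z ∈ L
      len : length L' ≡ suc (length L)

  insert : ∀ {lo hi L x} → Canonical x → InGap lo hi x →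
           (∀ {y} → y ∈ L → Canonical y × Comparable x y × x ≢ y) → Chain lo hi L →
           Insertion lo hi x L
  insert {lo} {hi} {[]} {x} cx (l , b , r) f (nil _ _) = record
    { L' = x ∷ [] ; sc = cons l (nil b r) ; xin = here refl ; sub = λ () ; sup = λ { (here e) → inj₁ e }
    ; len = refl }
  insert {lo} {hi} {y ∷ L} {x} cx g f (cons l s) with f (here refl)
  ... | cy , c , ne with comparable⇒Lt⊎Gt cx cy c ne
  ... | inj₁ xy = record
    { L' = x ∷ y ∷ L ; sc = cons (proj₁ g) (cons xy s) ; xin = here refl ; sub = there
    ; sup = λ { (here e) → inj₁ e ; (there i) → inj₂ i } ; len = refl }
  ... | inj₂ yx = record
    { L' = y ∷ L' ; sc = cons l sc ; xin = there xin
    ; sub = λ { (here e) → here e ; (there i) → there (sub i) }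
    ; sup = λ { (here e) → inj₂ (here e) ; (there i) → lift (sup i) }
    ; len = cong suc len }
    where
    open Insertion (insert cx (yx , proj₂ g) (λ i → f (there i)) s)
    lift : ∀ {z} → z ≡ x ⊎ z ∈ L → z ≡ x ⊎ z ∈ y ∷ L
    lift (inj₁ e) = inj₁ e
    lift (inj₂ i) = inj₂ (there i)

  record Sorted (F : List V) : Set where
    field
      L : List V
      sc : Chain zeroVec nothing L
      to : ∀ {z} → z ∈ F → z ∈ L
      from : ∀ {z} → z ∈ L → z ∈ F
      len : length L ≡ length F

  zeroVec-gap : ∀ (x : V) → Canonical x → InGap zeroVec nothing x
  zeroVec-gap x c =
    (zeroVec≼ x , subst (_< rank x) (sym (rank-zeroVec {n})) (canonical⇒rank>0 x c)) , tt , s≤s (rank-≤ x)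

  sortChain : (F : List V) → Unique F → All (InP n m) F →
              (∀ {x y} → x ∈ F → y ∈ F → Comparable x y) → Sorted F
  sortChain [] _ _ _ = record { L = [] ; sc = nil tt (subst (_< suc n) (sym (rank-zeroVec {n})) (s≤s z≤n))
                              ; to = λ () ; from = λ () ; len = refl }
  sortChain (x ∷ F) (nx ∷ u) (px ∷ ps) cm = record
    { L = L' ; sc = sc
    ; to = λ { (here refl) → xin ; (there i) → sub (Sorted.to S i) }
    ; from = λ i → back (sup i)
    ; len = trans len (cong suc (Sorted.len S)) }
    where
    S : Sorted F
    S = sortChain F u ps (λ i j → cm (there i) (there j))
    others : ∀ {y} → y ∈ Sorted.L S → Canonical y × Comparable x y × x ≢ y
    others i = let j = Sorted.from S i in
               proj₁ (All.lookup ps j) , cm (here refl) (there j) , All.lookup nx j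
    open Insertion (insert (proj₁ px) (zeroVec-gap x (proj₁ px)) others (Sorted.sc S))
    back : ∀ {z} → z ≡ x ⊎ z ∈ Sorted.L S → z ∈ x ∷ F
    back (inj₁ e) = here e
    back (inj₂ i) = there (Sorted.from S i)

  sortFace : ∀ {F} → Face F → Sorted F
  sortFace {F} (_ , u , ps , cm) = sortChain F u ps (λ i j → ≤P⇒Comparable (cm i j))

  sortedAll : ∀ {F} → Face F → (S : Sorted F) → All (InP n m) (Sorted.L S)
  sortedAll f S = All.tabulate (λ i → faceIn f (Sorted.from S i))

  -- Constructing vertices.  Between comparable vertices two ranks apart, and
  -- above any bound of rank < n, there is a vertex (stepUp resp. fill do not
  -- increase the variation).

  vertexBetween : ∀ {lo x : V} → InP n m x → lo ≼ x → suc (suc (rank lo)) ≤ rank x →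
                  Σ V λ v → InP n m v × Lt lo v × Lt v x
  vertexBetween {lo} {x} px p r with orientedTop p
  ... | mkOrientedTop c loc vrc rkc cx xc with stepUp loc (subst (rank lo <_) (sym rkc) (≤-trans (n≤1+n _) r))
  ... | α , la , ac , ra =
    canon α ,
    mkInP α (subst (0 <_) (sym ra) (s≤s z≤n))
      (≤-trans (variation-mono ac) (≤-trans (≤-reflexive vrc) (InP-variation {x} px))) ,
    (≼-trans (⊑⇒≼ la) (≼canon α) , subst (rank lo <_) (sym rα) ≤-refl) ,
    (≼-trans (canon≼ α) (≼-trans (⊑⇒≼ ac) cx) , subst (_< rank x) (sym rα) r)
    where
    rα : rank (canon α) ≡ suc (rank lo)
    rα = trans (rank-canon α) ra

  allPos : ∀ {k} → Vec Sign k
  allPos = fill pos zeroVec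

  allPos-variation : ∀ {k} → changesFrom pos (toList (allPos {k})) ≡ 0
  allPos-variation {zero} = refl
  allPos-variation {suc k} = allPos-variation {k}

  allPos-vertex : 0 < n → InP n m allPos
  allPos-vertex (s≤s _) =
    refl , subst (_≤ m) (sym (trans (var≡variation (allPos {n})) (allPos-variation {n}))) z≤n

  LowerOK : V → Set
  LowerOK lo = lo ≡ zeroVec ⊎ InP n m lo

  data UpperOK : Maybe V → Set where
    top : UpperOK nothing
    vertex : ∀ {b} → InP n m b → UpperOK (just b)

  vertexAbove : ∀ {lo : V} → LowerOK lo → rank lo < n → Σ V λ v → InP n m v × Lt lo v
  vertexAbove {lo} (inj₁ refl) r =
    allPos , allPos-vertex n>0 , zeroVec≼ allPos ,
    subst₂ _<_ (sym (rank-zeroVec {n})) (sym (fill-full pos zeroVec (λ ()))) n>0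
    where
    n>0 : 0 < n
    n>0 = ≤-trans (s≤s z≤n) r
  vertexAbove {lo} (inj₂ (clo , vlo)) r =
    fill (firstSign lo) lo ,
    (trans (firstSign-fill (firstSign lo) lo refl nzf) clo ,
     subst (_≤ m) (sym (trans (var≡variation (fill (firstSign lo) lo)) (variation-fill lo lo>0)))
       (InP-variation {lo} (clo , vlo))) ,
    ⊑⇒≼ (fill-sub (firstSign lo) lo) , subst (rank lo <_) (sym (fill-full (firstSign lo) lo nzf)) r
    where
    lo>0 : 0 < rank lo
    lo>0 = canonical⇒rank>0 lo clo
    nzf : Nonzero (firstSign lo)
    nzf = firstSign-nonzero lo lo>0

  vertexInGap : ∀ {lo hi} → LowerOK lo → UpperOK hi → BelowH lo hi → suc (suc (rank lo)) ≤ rankH hi →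
                Σ V λ v → InP n m v × InGap lo hi v
  vertexInGap lo-ok top _ r with vertexAbove lo-ok (≤-pred r)
  ... | v , pv , l = v , pv , l , tt , s≤s (rank-≤ v)
  vertexInGap lo-ok (vertex pb) b r with vertexBetween pb b r
  ... | v , pv , l , (p , q) = v , pv , l , p , q

  Fits : List V → V → Set
  Fits L v = ∀ {y} → y ∈ L → Comparable y v × y ≢ v

  below⇒fits : ∀ {v y : V} → Lt v y → Comparable y v × y ≢ v
  below⇒fits vy = inj₂ (proj₁ vy) , (λ q → Lt⇒≢ vy (sym q))

  fitsBelow : ∀ {x hi L v} → Lt v x → Chain x hi L → Fits (x ∷ L) v
  fitsBelow vx s (here refl) = below⇒fits vx
  fitsBelow vx s (there i) = below⇒fits (Lt-trans vx (proj₁ (Chain-mem s i)))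

  fitsAbove : ∀ {x L v} → Lt x v → Fits L v → Fits (x ∷ L) v
  fitsAbove xv f (here refl) = Lt⇒Comparable xv , Lt⇒≢ xv
  fitsAbove xv f (there i) = f i

  belowFirst : ∀ {lo x hi L v} → Chain x hi L → Lt lo v → Lt v x → InGap lo hi v
  belowFirst {hi = hi} s lv vx =
    lv , BelowH-trans hi (proj₁ vx) (proj₁ (Chain-top s)) , <-trans (proj₂ vx) (proj₂ (Chain-top s))

  tightOrFits : ∀ {lo hi L} → LowerOK lo → UpperOK hi → All (InP n m) L → Chain lo hi L →
                (suc (length L) + rank lo ≡ rankH hi) ⊎ Σ V λ v → InP n m v × InGap lo hi v × Fits L v
  tightOrFits {lo} {hi} lo-ok hi-ok _ (nil b r) with suc (rank lo) ≟ rankH hi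
  ... | yes e = inj₁ e
  ... | no ne with vertexInGap lo-ok hi-ok b (≤∧≢⇒< r ne)
  ... | v , pv , g = inj₂ (v , pv , g , λ ())
  tightOrFits {lo} {hi} {x ∷ L} lo-ok hi-ok (px ∷ ps) (cons l s) with tightOrFits (inj₂ px) hi-ok ps s
  ... | inj₂ (v , pv , (xv , bh , r) , f) = inj₂ (v , pv , (Lt-trans l xv , bh , r) , fitsAbove xv f)
  ... | inj₁ e with rank x ≟ suc (rank lo)
  ...   | yes e′ =
    inj₁ (trans (sym (+-suc (suc (length L)) (rank lo))) (trans (cong (suc (length L) +_) (sym e′)) e))
  ...   | no ne with vertexBetween px (proj₁ l) (≤∧≢⇒< (proj₂ l) (λ q → ne (sym q)))
  ...     | v , pv , lv , vx = inj₂ (v , pv , belowFirst s lv vx , fitsBelow vx s)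

  record Gap (lo : V) (hi : Maybe V) (L : List V) : Set where
    field
      a : V
      b : Maybe V
      aOK : a ≡ lo ⊎ a ∈ L
      bOK : b ≡ hi ⊎ Σ V λ b' → b ≡ just b' × b' ∈ L
      outside : ∀ {y} → y ∈ L → y ≼ a ⊎ AboveH b y

  gap-whole : ∀ {lo hi} → Gap lo hi []
  gap-whole {lo} {hi} = record { a = lo ; b = hi ; aOK = inj₁ refl ; bOK = inj₁ refl ; outside = λ () }

  gap-bottom : ∀ {lo x hi L} → Chain x hi L → Gap lo hi (x ∷ L)
  gap-bottom {lo} {x} s = record
    { a = lo ; b = just x ; aOK = inj₁ refl ; bOK = inj₂ (x , refl , here refl) ; outside = outside }
    where
    outside : ∀ {y} → y ∈ x ∷ _ → y ≼ lo ⊎ x ≼ y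
    outside (here refl) = inj₂ (≼-refl x)
    outside (there i) = inj₂ (proj₁ (proj₁ (Chain-mem s i)))

  gap-cons : ∀ {lo x hi L} → Chain x hi L → Gap x hi L → Gap lo hi (x ∷ L)
  gap-cons {lo} {x} {hi} {L} s G = record
    { a = a ; b = b ; aOK = inj₂ (aIn aOK) ; bOK = bIn bOK ; outside = outside′ }
    where
    open Gap G
    aIn : a ≡ x ⊎ a ∈ L → a ∈ x ∷ L
    aIn (inj₁ q) = here q
    aIn (inj₂ i) = there i
    bIn : b ≡ hi ⊎ Σ V (λ b' → b ≡ just b' × b' ∈ L) →
          b ≡ hi ⊎ Σ V (λ b' → b ≡ just b' × b' ∈ x ∷ L)
    bIn (inj₁ q) = inj₁ q
    bIn (inj₂ (b' , q , i)) = inj₂ (b' , q , there i)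
    xa : a ≡ x ⊎ a ∈ L → x ≼ a
    xa (inj₁ refl) = ≼-refl x
    xa (inj₂ i) = proj₁ (proj₁ (Chain-mem s i))
    outside′ : ∀ {y} → y ∈ x ∷ L → y ≼ a ⊎ AboveH b y
    outside′ (here refl) = inj₁ (xa aOK)
    outside′ (there i) = outside i

  tight-ranks : ∀ {lo hi L} → Chain lo hi L → suc (length L) + rank lo ≡ rankH hi →
                ∀ r → rank lo < r → r < rankH hi → Σ V λ y → y ∈ L × rank y ≡ r
  tight-ranks (nil _ _) e r p q = ⊥-elim (<⇒≱ q (≤-trans (≤-reflexive (sym e)) p))
  tight-ranks {lo} {hi} {x ∷ L} (cons l s) e r p q with rank x ≟ r
  ... | yes rx = x , here refl , rx
  ... | no rx with tight-ranks s (shift (suc (length L)) rxe e) r (≤∧≢⇒< (subst (_≤ r) (sym rxe) p) rx) q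
    where
    rxe : rank x ≡ suc (rank lo)
    rxe = squeeze (suc (length L)) (Chain-count s) e (proj₂ l)
  ... | y , i , ry = y , there i , ry

  record OneGap (lo : V) (hi : Maybe V) (L : List V) : Set where
    field
      gap : Gap lo hi L
      rk : rankH (Gap.b gap) ≡ suc (suc (rank (Gap.a gap)))
      ranks : ∀ r → rank lo < r → r < rankH hi → r ≢ suc (rank (Gap.a gap)) →
              Σ V λ y → y ∈ L × rank y ≡ r

  oneGap-bottom : ∀ {lo hi x L} → Lt lo x → Chain x hi L → rank x ≡ suc (suc (rank lo)) →
                  suc (length L) + rank x ≡ rankH hi → OneGap lo hi (x ∷ L)
  oneGap-bottom {lo} {hi} {x} {L} l s rx e = record { gap = gap-bottom s ; rk = rx ; ranks = ranks }
    where
    ranks : ∀ r → rank lo < r → r < rankH hi → r ≢ suc (rank lo) →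
            Σ V λ y → y ∈ x ∷ L × rank y ≡ r
    ranks r p q ne with rank x ≟ r
    ... | yes xr = x , here refl , xr
    ... | no xr with tight-ranks s e r (≤∧≢⇒< (subst (_≤ r) (sym rx) (<-skip p ne)) xr) q
    ...   | y , i , ry = y , there i , ry

  oneGap-cons : ∀ {lo hi x L} → Chain x hi L → rank x ≡ suc (rank lo) → OneGap x hi L →
                OneGap lo hi (x ∷ L)
  oneGap-cons {lo} {hi} {x} {L} s rx G = record { gap = gap-cons s (OneGap.gap G) ; rk = OneGap.rk G ; ranks = ranks }
    where
    ranks : ∀ r → rank lo < r → r < rankH hi → r ≢ suc (rank (Gap.a (OneGap.gap G))) →
            Σ V λ y → y ∈ x ∷ L × rank y ≡ r
    ranks r p q ne with rank x ≟ r
    ... | yes xr = x , here refl , xr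
    ... | no xr with OneGap.ranks G r (≤∧≢⇒< (subst (_≤ r) (sym rx) p) xr) q ne
    ...   | y , i , ry = y , there i , ry

  oneGap : ∀ {lo hi L} → Chain lo hi L → suc (suc (length L)) + rank lo ≡ rankH hi → OneGap lo hi L
  oneGap {lo} {hi} (nil _ _) e = record
    { gap = gap-whole ; rk = sym e
    ; ranks = λ r p q ne → ⊥-elim (ne (≤-antisym (≤-pred (≤-trans q (≤-reflexive (sym e)))) p)) }
  oneGap {lo} {hi} {x ∷ L} (cons l s) e with rank x ≟ suc (rank lo)
  ... | yes rx = oneGap-cons s rx (oneGap s (shift (suc (suc (length L))) rx e))
  ... | no rx = oneGap-bottom l s rx2 (shift (suc (length L)) rx2 e′)
    where
    e′ : suc (suc (length L)) + suc (rank lo) ≡ rankH hi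
    e′ = shift (suc (suc (length L))) refl e
    rx2 : rank x ≡ suc (suc (rank lo))
    rx2 = squeeze (suc (length L)) (Chain-count s) e′ (≤∧≢⇒< (proj₂ l) (λ q → rx (sym q)))

  Separates : V → V → V → Set
  Separates f u v = (Lt u f × Lt f v) ⊎ (Lt v f × Lt f u)

  -- Either some element f of L separates v from another vertex u that can
  -- be added to L, ...
  record Separated (lo : V) (hi : Maybe V) (L : List V) (v : V) : Set where
    field
      u : V
      pu : InP n m u
      gu : InGap lo hi u
      fu : Fits L u
      f : V
      fL : f ∈ L
      sep : Separates f u v

  -- ... or v lies in a gap (a, b) of L; cnt records the number of elements
  -- of L, from which the width of the gap is computed.
  record SameGap (lo : V) (hi : Maybe V) (L : List V) (v : V) : Set where
    field
      gap : Gap lo hi L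
    open Gap gap
    field
      av : Lt a v
      vb : BelowH v b × rank v < rankH b
      cnt : length L + rankH b + rank lo ≡ rankH hi + rank a

  separated-cons : ∀ {lo x hi L v} → Lt lo x → Separated x hi L v → Separated lo hi (x ∷ L) v
  separated-cons l A = record
    { u = u ; pu = pu ; gu = Lt-trans l (proj₁ gu) , proj₂ gu
    ; fu = fitsAbove (proj₁ gu) fu ; f = f ; fL = there fL ; sep = sep }
    where open Separated A

  sepOrSame-above : ∀ {lo x hi L v} → InP n m x → Lt lo x → Chain x hi L → Lt x v →
                    Separated x hi L v ⊎ SameGap x hi L v →
                    Separated lo hi (x ∷ L) v ⊎ SameGap lo hi (x ∷ L) v
  sepOrSame-above px l s xv (inj₁ A) = inj₁ (separated-cons l A)
  sepOrSame-above {lo} {x} {hi} {L} px l s xv (inj₂ G) with rank x ≟ suc (rank lo)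
  ... | yes e = inj₂ record
    { gap = gap-cons s gap ; av = av ; vb = vb
    ; cnt = trans (sym (+-suc (length L + rankH b) (rank lo))) (trans (cong (length L + rankH b +_) (sym e)) cnt) }
    where
    open SameGap G
    open Gap gap
  ... | no ne with vertexBetween px (proj₁ l) (≤∧≢⇒< (proj₂ l) (λ q → ne (sym q)))
  ...   | u , pu , lu , ux = inj₁ record
    { u = u ; pu = pu ; gu = belowFirst s lu ux ; fu = fitsBelow ux s ; f = x ; fL = here refl
    ; sep = inj₁ (ux , xv) }

  -- v lies below the first element x: it is in the bottom gap, unless the
  -- tail has room for a vertex u above x.
  sepOrSame-below : ∀ {lo x hi L v} → Lt lo x → Chain x hi L → Lt lo v → Lt v x →
                    (suc (length L) + rank x ≡ rankH hi) ⊎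
                    (Σ V λ u → InP n m u × InGap x hi u × Fits L u) →
                    Separated lo hi (x ∷ L) v ⊎ SameGap lo hi (x ∷ L) v
  sepOrSame-below {lo} l s lv vx (inj₁ e) = inj₂ record
    { gap = gap-bottom s ; av = lv ; vb = vx ; cnt = cong (_+ rank lo) e }
  sepOrSame-below {x = x} l s lv vx (inj₂ (u , pu , (xu , bh , r) , fu)) = inj₁ record
    { u = u ; pu = pu ; gu = Lt-trans l xu , bh , r ; fu = fitsAbove xu fu ; f = x ; fL = here refl
    ; sep = inj₂ (vx , xu) }

  separatedOrSameGap : ∀ {lo hi L v} → LowerOK lo → UpperOK hi → All (InP n m) L → Chain lo hi L →
                       InP n m v → InGap lo hi v → Fits L v → Separated lo hi L v ⊎ SameGap lo hi L v
  separatedOrSameGap _ _ _ (nil _ _) pv (lv , vb) _ =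
    inj₂ record { gap = gap-whole ; av = lv ; vb = vb ; cnt = refl }
  separatedOrSameGap lo-ok hi-ok (px ∷ ps) (cons l s) pv (lv , vb) fv
    with comparable⇒Lt⊎Gt (proj₁ px) (proj₁ pv) (proj₁ (fv (here refl))) (proj₂ (fv (here refl)))
  ... | inj₁ xv =
    sepOrSame-above px l s xv (separatedOrSameGap (inj₂ px) hi-ok ps s pv (xv , vb) (λ i → fv (there i)))
  ... | inj₂ vx = sepOrSame-below l s lv vx (tightOrFits (inj₂ px) hi-ok ps s)

module Pseudomanifold (k m : ℕ) where
  open Chains (suc k) m

  n : ℕ
  n = suc k

  rank-zeroVec-n : rank (zeroVec {n}) ≡ 0
  rank-zeroVec-n = rank-zeroVec {n}

  -- Facets have n vertices: a sorted face with fewer ranks can be extended.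
  facetLen : ∀ {F} → Facet Face F → length F ≡ n
  facetLen {F} (f , maximal) = extend (tightOrFits (inj₁ refl) top (sortedAll f S) (Sorted.sc S))
    where
    S : Sorted F
    S = sortFace f
    extend : (suc (length (Sorted.L S)) + rank (zeroVec {n}) ≡ suc n) ⊎
             (Σ V λ v → InP n m v × InGap zeroVec nothing v × Fits (Sorted.L S) v) → length F ≡ n
    extend (inj₁ e) = trans (sym (Sorted.len S))
      (suc-injective (trans (sym (+-identityʳ _))
        (trans (cong (suc (length (Sorted.L S)) +_) (sym rank-zeroVec-n)) e)))
    extend (inj₂ (v , pv , _ , fits)) =
      ⊥-elim (v∉F (maximal (v ∷ F) (faceCons f pv v∉F cv) there (here refl)))
      where
      v∉F : v ∉ F
      v∉F i = proj₂ (fits (Sorted.to S i)) refl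
      cv : ∀ {y} → y ∈ F → Comparable y v
      cv i = proj₁ (fits (Sorted.to S i))

  -- A facet exists: the chain of prefixes (+,..,+,0,..,0) of variation 0.

  prefix : ∀ {j} → ℕ → Vec Sign j
  prefix {zero} _ = []
  prefix {suc j} zero = zer ∷ prefix zero
  prefix {suc j} (suc i) = pos ∷ prefix i

  prefix-zero : ∀ {j} → prefix {j} 0 ≡ zeroVec
  prefix-zero {zero} = refl
  prefix-zero {suc j} = cong (zer ∷_) (prefix-zero {j})

  prefix-⊑ : ∀ {j} i → prefix {j} i ⊑ prefix (suc i)
  prefix-⊑ {zero} i = []
  prefix-⊑ {suc j} zero = erase pos (⊑-refl (prefix {j} 0))
  prefix-⊑ {suc j} (suc i) = keep pos (prefix-⊑ {j} i)

  prefix-rank : ∀ {j} i → i ≤ j → rank (prefix {j} i) ≡ i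
  prefix-rank {zero} zero _ = refl
  prefix-rank {suc j} zero _ = prefix-rank {j} zero z≤n
  prefix-rank {suc j} (suc i) (s≤s h) = cong suc (prefix-rank {j} i h)

  prefix-variation : ∀ {j} i → changesFrom pos (toList (prefix {j} i)) ≡ 0
  prefix-variation {zero} i = refl
  prefix-variation {suc j} zero = prefix-variation {j} zero
  prefix-variation {suc j} (suc i) = prefix-variation {j} i

  prefix-vertex : ∀ i → InP n m (prefix (suc i))
  prefix-vertex i =
    refl , subst (_≤ m) (sym (trans (var≡variation (prefix {n} (suc i))) (prefix-variation {k} i))) z≤n

  -- prefixChain j r = prefix (j+1), ..., prefix (j+r)
  prefixChain : ℕ → ℕ → List V
  prefixChain j zero = []
  prefixChain j (suc r) = prefix (suc j) ∷ prefixChain (suc j) r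

  prefixChain-length : ∀ j r → length (prefixChain j r) ≡ r
  prefixChain-length j zero = refl
  prefixChain-length j (suc r) = cong suc (prefixChain-length (suc j) r)

  prefixChain-vertices : ∀ j r → All (InP n m) (prefixChain j r)
  prefixChain-vertices j zero = []
  prefixChain-vertices j (suc r) = prefix-vertex j ∷ prefixChain-vertices (suc j) r

  prefixChain-chain : ∀ j r → j + r ≡ n → Chain (prefix j) nothing (prefixChain j r)
  prefixChain-chain j zero e = nil tt (s≤s (rank-≤ (prefix {n} j)))
  prefixChain-chain j (suc r) e =
    cons (⊑⇒≼ (prefix-⊑ j) , rank<) (prefixChain-chain (suc j) r (trans (sym (+-suc j r)) e))
    where
    j<n : suc j ≤ n
    j<n = subst (suc j ≤_) (trans (sym (+-suc j r)) e) (s≤s (m≤m+n j r))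
    rank< : rank (prefix {n} j) < rank (prefix {n} (suc j))
    rank< = subst₂ _<_ (sym (prefix-rank j (≤-trans (n≤1+n j) j<n))) (sym (prefix-rank (suc j) j<n)) ≤-refl

  bigFace : Σ (List V) λ F → Face F × length F ≡ n
  bigFace = prefixChain 0 n ,
            ((λ ()) , Chain-unique c , prefixChain-vertices 0 n ,
             (λ i j → Comparable⇒≤P (Chain-comparable c i j))) ,
            prefixChain-length 0 n
    where
    c : Chain zeroVec nothing (prefixChain 0 n)
    c = subst (λ z → Chain z nothing (prefixChain 0 n)) (prefix-zero {n}) (prefixChain-chain 0 n refl)

  rankH-≤ : ∀ b → rankH b ≤ suc n
  rankH-≤ nothing = ≤-refl
  rankH-≤ (just b) = ≤-trans (rank-≤ b) (n≤1+n n)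

  zeroVec<rank : ∀ {x : V} → Canonical x → rank (zeroVec {n}) < rank x
  zeroVec<rank {x} c = subst (_< rank x) (sym rank-zeroVec-n) (canonical⇒rank>0 x c)

  -- A face F with n - 1 vertices misses exactly one rank, rank a + 1
  -- in its gap (a, b); a facet G ⊇ F is F plus a vertex x of that rank, and
  -- by the diamond property at most two such x exist.

  record NewVertex (F G : List V) (a : V) : Set where
    field
      x : V
      xG : x ∈ G
      rx : rank x ≡ suc (rank a)
      ax : a ≼ x
      G⊆ : G ⊆ x ∷ F
      ⊆G : x ∷ F ⊆ G

  newVertex-≋ : ∀ {F G G' a} (P : NewVertex F G a) (P' : NewVertex F G' a) →
                NewVertex.x P ≡ NewVertex.x P' → G ≋ G'
  newVertex-≋ {F} P P' e =
    (λ i → NewVertex.⊆G P' (subst (λ z → _ ∈ z ∷ F) e (NewVertex.G⊆ P i))) ,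
    (λ i → NewVertex.⊆G P (subst (λ z → _ ∈ z ∷ F) (sym e) (NewVertex.G⊆ P' i)))

  module Thinness {F : List V} (fF : Face F) (lenF : length F ≡ k) where
    S : Sorted F
    S = sortFace fF

    LF : List V
    LF = Sorted.L S

    OG : OneGap zeroVec nothing LF
    OG = oneGap (Sorted.sc S) (trans (cong (suc (suc (length LF)) +_) rank-zeroVec-n)
           (trans (+-identityʳ _) (cong (λ z → suc (suc z)) (trans (Sorted.len S) lenF))))
    open Gap (OneGap.gap OG)

    newVertex : ∀ {G} → Facet Face G → F ⊆ G → NewVertex F G a
    newVertex {G} (fG , maximal) F⊆G =
      record { x = x ; xG = xG ; rx = rx ; ax = ax aOK ; G⊆ = G⊆ ; ⊆G = ⊆G }
      where
      SG : Sorted G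
      SG = sortFace fG
      tight : suc (length (Sorted.L SG)) + rank (zeroVec {n}) ≡ rankH nothing
      tight = trans (cong (suc (length (Sorted.L SG)) +_) rank-zeroVec-n)
                (trans (+-identityʳ _) (cong suc (trans (Sorted.len SG) (facetLen (fG , maximal)))))
      -- G is tight, so it has a vertex x at the missing rank.
      T : Σ V λ y → y ∈ Sorted.L SG × rank y ≡ suc (rank a)
      T = tight-ranks (Sorted.sc SG) tight (suc (rank a))
            (subst (_< suc (rank a)) (sym rank-zeroVec-n) (s≤s z≤n))
            (≤-trans (≤-reflexive (sym (OneGap.rk OG))) (rankH-≤ b))
      x : V
      x = proj₁ T
      xG : x ∈ G
      xG = Sorted.from SG (proj₁ (proj₂ T))
      rx : rank x ≡ suc (rank a)
      rx = proj₂ (proj₂ T)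
      ax : a ≡ zeroVec ⊎ a ∈ LF → a ≼ x
      ax (inj₁ e) = subst (_≼ x) (sym e) (zeroVec≼ x)
      ax (inj₂ i) = proj₁ (comparable∧rank<⇒Lt (faceCmp fG (F⊆G (Sorted.from S i)) xG)
                                                 (subst (rank a <_) (sym rx) ≤-refl))
      G⊆ : G ⊆ x ∷ F
      G⊆ {g} i with rank g ≟ suc (rank a)
      ... | yes e = here (sameRank fG i xG (trans e (sym rx)))
      ... | no ne with OneGap.ranks OG (rank g) (zeroVec<rank {g} (proj₁ (faceIn fG i))) (s≤s (rank-≤ g)) ne
      ...   | y , j , ry =
        there (subst (_∈ F) (sym (sameRank fG i (F⊆G (Sorted.from S j)) (sym ry))) (Sorted.from S j))
      ⊆G : x ∷ F ⊆ G
      ⊆G (here refl) = xG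
      ⊆G (there i) = F⊆G i

    newVertex-below : ∀ {G} (fG : Facet Face G) (F⊆G : F ⊆ G) (P : NewVertex F G a) {b'} → b' ∈ LF →
                      rank b' ≡ suc (suc (rank a)) → NewVertex.x P ≼ b'
    newVertex-below fG F⊆G P {b'} i rb =
      proj₁ (comparable∧rank<⇒Lt (faceCmp (proj₁ fG) (NewVertex.xG P) (F⊆G (Sorted.from S i)))
              (subst (_< rank b') (sym (NewVertex.rx P)) (subst (suc (rank a) <_) (sym rb) ≤-refl)))

    thin : ∀ {G₁ G₂ G₃} → Facet Face G₁ → Facet Face G₂ → Facet Face G₃ →
           F ⊆ G₁ → F ⊆ G₂ → F ⊆ G₃ → G₁ ≋ G₂ ⊎ G₁ ≋ G₃ ⊎ G₂ ≋ G₃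
    thin {G₁} {G₂} {G₃} f1 f2 f3 s1 s2 s3 = sameFacets (twoEqual bOK)
      where
      P1 : NewVertex F G₁ a
      P1 = newVertex f1 s1
      P2 : NewVertex F G₂ a
      P2 = newVertex f2 s2
      P3 : NewVertex F G₃ a
      P3 = newVertex f3 s3
      open NewVertex P1 renaming (x to x1; ax to a1; rx to r1)
      open NewVertex P2 renaming (x to x2; ax to a2; rx to r2)
      open NewVertex P3 renaming (x to x3; ax to a3; rx to r3)
      c1 : Canonical x1
      c1 = proj₁ (faceIn (proj₁ f1) (NewVertex.xG P1))
      c2 : Canonical x2
      c2 = proj₁ (faceIn (proj₁ f2) (NewVertex.xG P2))
      c3 : Canonical x3
      c3 = proj₁ (faceIn (proj₁ f3) (NewVertex.xG P3))
      twoEqual : b ≡ nothing ⊎ Σ V (λ b' → b ≡ just b' × b' ∈ LF) → SomeTwoEqual x1 x2 x3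
      twoEqual (inj₁ e) = topCovers-canonical c1 c2 c3 ra a1 a2 a3 (trans r1 ra) (trans r2 ra) (trans r3 ra)
        where
        ra : suc (rank a) ≡ n
        ra = sym (suc-injective (trans (cong rankH (sym e)) (OneGap.rk OG)))
      twoEqual (inj₂ (b' , e , i)) =
        diamond-canonical c1 c2 c3 (≼-trans a1 (below P1 f1 s1)) rb
          (a1 , below P1 f1 s1 , r1) (a2 , below P2 f2 s2 , r2) (a3 , below P3 f3 s3 , r3)
        where
        rb : rank b' ≡ suc (suc (rank a))
        rb = trans (cong rankH (sym e)) (OneGap.rk OG)
        below : ∀ {G} (P : NewVertex F G a) (fG : Facet Face G) (F⊆G : F ⊆ G) → NewVertex.x P ≼ b'
        below P fG F⊆G = newVertex-below fG F⊆G P i rb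
      sameFacets : SomeTwoEqual x1 x2 x3 → G₁ ≋ G₂ ⊎ G₁ ≋ G₃ ⊎ G₂ ≋ G₃
      sameFacets (inj₁ e) = inj₁ (newVertex-≋ P1 P2 e)
      sameFacets (inj₂ (inj₁ e)) = inj₂ (inj₁ (newVertex-≋ P1 P3 e))
      sameFacets (inj₂ (inj₂ e)) = inj₂ (inj₂ (newVertex-≋ P2 P3 e))

  -- Two vertices of the link of F are joined by an
  -- edge path: through at most one vertex when a vertex of F separates them,
  -- and otherwise inside their common gap (a, b) of F, which is at least four
  -- ranks wide.
  nonempty-member : ∀ {A : Set} (xs : List A) → xs ≢ [] → Σ A (_∈ xs)
  nonempty-member [] ne = ⊥-elim (ne refl)
  nonempty-member (x ∷ xs) _ = x , here refl

  module LinkConnectivity {F : List V} (fF : Face F) where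
    K : List V → Set
    K = Link Face F

    LinkVertex : V → Set
    LinkVertex v = InP n m v × v ∉ F × (∀ {f} → f ∈ F → Comparable f v)

    linkVertex : ∀ {v} → K (v ∷ []) → LinkVertex v
    linkVertex {v} (fv , fFv , dj) = faceIn fv (here refl) , (λ i → dj i (here refl)) ,
      (λ i → faceCmp fFv (∈-++⁺ˡ i) (∈-++⁺ʳ F (here refl)))

    linkEdge : ∀ {u v} → LinkVertex u → LinkVertex v → u ≢ v → Comparable u v → K (u ∷ v ∷ [])
    linkEdge {u} {v} (pu , nu , cu) (pv , nv , cv) ne c = edge , withF , dj
      where
      uv-unique : Unique (u ∷ v ∷ [])
      uv-unique = (ne ∷ []) ∷ ([] ∷ [])
      cmp : ∀ {x y} → x ∈ u ∷ v ∷ [] → y ∈ u ∷ v ∷ [] → Comparable x y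
      cmp (here refl) (here refl) = inj₁ (≼-refl u)
      cmp (here refl) (there (here refl)) = c
      cmp (there (here refl)) (here refl) = Comparable-sym c
      cmp (there (here refl)) (there (here refl)) = inj₁ (≼-refl v)
      edge : Face (u ∷ v ∷ [])
      edge = (λ ()) , uv-unique , (pu ∷ pv ∷ []) , (λ i j → Comparable⇒≤P (cmp i j))
      dj : Disjoint F (u ∷ v ∷ [])
      dj i (here refl) = nu i
      dj i (there (here refl)) = nv i
      nonempty : ∀ (G : List V) → G ++ u ∷ v ∷ [] ≢ []
      nonempty [] ()
      nonempty (_ ∷ _) ()
      cmpF : ∀ {x y} → x ∈ F ++ u ∷ v ∷ [] → y ∈ F ++ u ∷ v ∷ [] → Comparable x y
      cmpF i j with ∈-++⁻ F i | ∈-++⁻ F j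
      ... | inj₁ i' | inj₁ j' = faceCmp fF i' j'
      ... | inj₁ i' | inj₂ (here refl) = cu i'
      ... | inj₁ i' | inj₂ (there (here refl)) = cv i'
      ... | inj₂ (here refl) | inj₁ j' = Comparable-sym (cu j')
      ... | inj₂ (there (here refl)) | inj₁ j' = Comparable-sym (cv j')
      ... | inj₂ i' | inj₂ j' = cmp i' j'
      withF : Face (F ++ u ∷ v ∷ [])
      withF = nonempty F , UP.++⁺ (proj₁ (proj₂ fF)) uv-unique (λ { (i , j) → dj i j }) ,
              AllP.++⁺ (faceAll fF) (pu ∷ pv ∷ []) , (λ i j → Comparable⇒≤P (cmpF i j))

    edge-sym : ∀ {u v} → K (u ∷ v ∷ []) → K (v ∷ u ∷ [])
    edge-sym {u} {v} (edge , withF , dj) = linkEdge (link (there (here refl))) (link (here refl)) ne′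
                                                    (faceCmp edge (there (here refl)) (here refl))
      where
      link : ∀ {x} → x ∈ u ∷ v ∷ [] → LinkVertex x
      link j = faceIn edge j , (λ i → dj i j) , (λ i → faceCmp withF (∈-++⁺ˡ i) (∈-++⁺ʳ F j))
      ne′ : v ≢ u
      ne′ with proj₁ (proj₂ edge)
      ... | (u≢v ∷ []) ∷ _ = λ e → u≢v (sym e)

    walk-++ : ∀ {u v w} → Walk K u v → Walk K v w → Walk K u w
    walk-++ here q = q
    walk-++ (step e p) q = step e (walk-++ p q)

    walk-reverse : ∀ {u v} → Walk K u v → Walk K v u
    walk-reverse here = here
    walk-reverse (step e p) = walk-++ (walk-reverse p) (step (edge-sym e) here)

    stepOrStay : ∀ {u v w} → LinkVertex u → LinkVertex v → Comparable u v → Walk K v w → Walk K u w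
    stepOrStay {u} {v} lu lv c p with VP.≡-dec _≟S_ u v
    ... | yes refl = p
    ... | no ne = step (linkEdge lu lv ne c) p

    edgeWalk : ∀ {u v} → LinkVertex u → LinkVertex v → Comparable u v → Walk K u v
    edgeWalk lu lv c = stepOrStay lu lv c here

    upWalk : ∀ {z1 z2 w} → LinkVertex (canon z1) → LinkVertex (canon z2) → z1 ⊑ z2 →
             Walk K (canon z2) w → Walk K (canon z1) w
    upWalk l1 l2 d p = stepOrStay l1 l2 (inj₁ (canon-mono d)) p

    downWalk : ∀ {z1 z2 w} → LinkVertex (canon z1) → LinkVertex (canon z2) → z2 ⊑ z1 →
               Walk K (canon z2) w → Walk K (canon z1) w
    downWalk l1 l2 d p = stepOrStay l1 l2 (inj₂ (canon-mono d)) p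

    gap⇒LinkVertex : ∀ {a z} (b : Maybe V) → (∀ {y} → y ∈ F → y ≼ a ⊎ AboveH b y) →
                     InP n m z → InGap a b z →
                     LinkVertex z
    gap⇒LinkVertex {a} {z} nothing outside pz (az , _ , _) = pz , z∉F , cz
      where
      z∉F : z ∉ F
      z∉F i with outside i
      ... | inj₁ za = <⇒≱ (proj₂ az) (rank-mono≼ za)
      cz : ∀ {f} → f ∈ F → Comparable f z
      cz i with outside i
      ... | inj₁ fa = inj₁ (≼-trans fa (proj₁ az))
    gap⇒LinkVertex {a} {z} (just b) outside pz (az , zb , rz) = pz , z∉F , cz
      where
      z∉F : z ∉ F
      z∉F i with outside i
      ... | inj₁ za = <⇒≱ (proj₂ az) (rank-mono≼ za)
      ... | inj₂ bz = <⇒≱ rz (rank-mono≼ bz)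
      cz : ∀ {f} → f ∈ F → Comparable f z
      cz i with outside i
      ... | inj₁ fa = inj₁ (≼-trans fa (proj₁ az))
      ... | inj₂ bf = inj₂ (≼-trans zb bf)

    -- The rank arithmetic of the join and meet moves below.
    join-rank-bound : ∀ J M v r → J + M ≡ v + suc r → r ≤ M → J ≤ suc v
    join-rank-bound J M v r e h = +-cancelʳ-≤ M J (suc v) (begin
        J + M       ≡⟨ e ⟩
        v + suc r   ≡⟨ +-suc v r ⟩
        suc (v + r) ≤⟨ s≤s (+-monoʳ-≤ v h) ⟩
        suc v + M   ∎)
      where open ≤-Reasoning

    meet-rank-bound : ∀ J M v w c r → J + M ≡ v + w → J ≤ c → suc v ≡ c → suc w ≡ c →
                      suc (suc (suc r)) ≤ c → r < M
    meet-rank-bound J M v w c r e jc ev ew rc = +-cancelˡ-≤ (suc (suc c)) (suc r) M (begin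
        suc (suc c) + suc r
          ≡⟨ solve 2 (λ c r → (con 2 :+ c) :+ (con 1 :+ r) := (con 3 :+ r) :+ c) refl c r ⟩
        suc (suc (suc r)) + c   ≤⟨ +-monoˡ-≤ c rc ⟩
        c + c                   ≡⟨ cong₂ _+_ (sym ev) (sym ew) ⟩
        suc v + suc w           ≡⟨ cong suc (+-suc v w) ⟩
        suc (suc (v + w))       ≡⟨ cong (λ z → suc (suc z)) (sym e) ⟩
        suc (suc (J + M))       ≤⟨ s≤s (s≤s (+-monoˡ-≤ M jc)) ⟩
        suc (suc c) + M         ∎)
      where open ≤-Reasoning

    -- A bounded gap (a, b') of F with b' a vertex, oriented by a ⊑ c = ±b'.
    -- Its oriented interior is connected: move up to a join and down to a
    -- common neighbour, or, when both ends sit right below c, through their meet.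
    module BoundedGap (a b' : V) (outside : ∀ {y} → y ∈ F → y ≼ a ⊎ AboveH (just b') y) (pb : InP n m b')
                      (ab : a ≼ b') (wide : suc (suc (suc (rank a))) ≤ rank b') where
      open OrientedTop (orientedTop ab)

      Inside : V → Set
      Inside z = a ⊑ z × z ⊑ c × rank a < rank z × rank z < rank c

      inside⇒LinkVertex : ∀ {z} → Inside z → LinkVertex (canon z)
      inside⇒LinkVertex {z} (az , zc , r1 , r2) = gap⇒LinkVertex (just b') outside
        (mkInP z (≤-trans (s≤s z≤n) r1)
          (≤-trans (variation-mono zc) (≤-trans (≤-reflexive vrc) (InP-variation {b'} pb))))
        ((≼-trans (⊑⇒≼ az) (≼canon z) , subst (rank a <_) (sym (rank-canon z)) r1) ,
         ≼-trans (canon≼ z) (≼-trans (⊑⇒≼ zc) cx) ,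
         subst₂ _<_ (sym (rank-canon z)) rkc r2)

      -- v has room above it: v ↑ J ↓ α ↑ w with α a cover of a below w and
      -- J the join of v and α, of rank at most rank v + 1.
      viaJoin : ∀ {v w} → Inside v → Inside w → suc (suc (rank v)) ≤ rank c → Walk K (canon v) (canon w)
      viaJoin {v} {w} ov@(av , vc , rv1 , rv2) ow@(aw , wc , rw1 , rw2) h with stepUp aw rw1
      ... | α , aα , αw , rα =
        upWalk (inside⇒LinkVertex ov) (inside⇒LinkVertex oJ) xJ
          (downWalk (inside⇒LinkVertex oJ) (inside⇒LinkVertex oα) yJ
            (upWalk (inside⇒LinkVertex oα) (inside⇒LinkVertex ow) αw here))
        where
        open JoinMeet (joinMeet vc (⊑-trans αw wc))
        rJ : rank J ≤ suc (rank v)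
        rJ = join-rank-bound (rank J) (rank M) (rank v) (rank a) (trans rk (cong (rank v +_) rα))
                             (rank-mono (glb av aα))
        oJ : Inside J
        oJ = ⊑-trans av xJ , Jc , <-≤-trans rv1 (rank-mono xJ) , ≤-trans (s≤s rJ) h
        oα : Inside α
        oα = aα , ⊑-trans αw wc , subst (rank a <_) (sym rα) ≤-refl , ≤-<-trans (rank-mono αw) rw2

      -- Both right below c: their meet M is still above a, since c is at least
      -- three ranks above a.
      viaMeet : ∀ {v w} → Inside v → Inside w → suc (rank v) ≡ rank c → suc (rank w) ≡ rank c →
                Walk K (canon v) (canon w)
      viaMeet {v} {w} ov@(av , vc , rv1 , rv2) ow@(aw , wc , rw1 , rw2) ev ew =
        downWalk (inside⇒LinkVertex ov) (inside⇒LinkVertex oM) Mx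
          (upWalk (inside⇒LinkVertex oM) (inside⇒LinkVertex ow) My here)
        where
        open JoinMeet (joinMeet vc wc)
        oM : Inside M
        oM = glb av aw , ⊑-trans Mx vc ,
             meet-rank-bound (rank J) (rank M) (rank v) (rank w) (rank c) (rank a) rk (rank-mono Jc) ev ew
               (subst (_ ≤_) (sym rkc) wide) ,
             ≤-<-trans (rank-mono Mx) rv2

      insideWalk : ∀ {v w} → Inside v → Inside w → Walk K (canon v) (canon w)
      insideWalk {v} {w} ov ow with suc (suc (rank v)) ≤? rank c | suc (suc (rank w)) ≤? rank c
      ... | yes h | _ = viaJoin ov ow h
      ... | no _ | yes h = walk-reverse (viaJoin ow ov h)
      ... | no h1 | no h2 = viaMeet ov ow (≤-antisym (proj₂ (proj₂ (proj₂ ov))) (≮⇒≥ h1))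
                                          (≤-antisym (proj₂ (proj₂ (proj₂ ow))) (≮⇒≥ h2))

      orientInside : ∀ {z} → Lt a z → Lt z b' → Σ V λ z′ → Inside z′ × (z′ ≡ z ⊎ z′ ≡ negV z)
      orientInside (az , raz) (zb , rzb) with orientBetween az (≼-trans zb xc) loc
      ... | z′ , az′ , z′c , e =
        z′ , (az′ , z′c , subst (rank a <_) (sym (rank-rep e)) raz ,
              subst₂ _<_ (sym (rank-rep e)) (sym rkc) rzb) , e

      gapWalk : ∀ {v w} → InP n m v → InP n m w → Lt a v → Lt v b' → Lt a w → Lt w b' → Walk K v w
      gapWalk pv pw av vb aw wb with orientInside av vb | orientInside aw wb
      ... | v′ , ov , ev | w′ , ow , ew =
        subst₂ (Walk K) (canon-rep (proj₁ pv) ev) (canon-rep (proj₁ pw) ew) (insideWalk ov ow)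

    -- Every vertex above a is joined to a
    -- hub, the canonical form of u = fill a: go up to a full vector x, down
    -- to a with the entry of x at a free slot i, up into u changed at i,
    -- down to a with the entry of u at another zero j, and up to u.
    module TopGap (a : V) (outside : ∀ {y} → y ∈ F → y ≼ a ⊎ AboveH nothing y) (pa : InP n m a)
                  (wide : suc (suc (suc (rank a))) ≤ n) where
      Inside : V → Set
      Inside z = a ⊑ z × rank a < rank z × variation z ≤ m

      inside⇒LinkVertex : ∀ {z} → Inside z → LinkVertex (canon z)
      inside⇒LinkVertex {z} (az , r1 , vz) = gap⇒LinkVertex nothing outside
        (mkInP z (≤-trans (s≤s z≤n) r1) vz)
        ((≼-trans (⊑⇒≼ az) (≼canon z) , subst (rank a <_) (sym (rank-canon z)) r1) , tt ,
         s≤s (rank-≤ (canon z)))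

      a>0 : 0 < rank a
      a>0 = canonical⇒rank>0 a (proj₁ pa)

      a<n : rank a < n
      a<n = ≤-trans (n≤1+n _) (≤-trans (n≤1+n _) wide)

      nzA : Nonzero (firstSign a)
      nzA = firstSign-nonzero a a>0

      u : V
      u = fill (firstSign a) a

      au : a ⊑ u
      au = fill-sub (firstSign a) a

      ou : Inside u
      ou = au , <-≤-trans a<n (≤-reflexive (sym (fill-full (firstSign a) a nzA))) ,
           ≤-trans (≤-reflexive (variation-fill a a>0)) (InP-variation {a} pa)

      hub : V
      hub = canon u

      rank-set : ∀ p y → lookup a p ≡ zer → Nonzero y → rank (a [ p ]≔ y) ≡ suc (rank a)
      rank-set p y z hy = trans (rank-update a p y z) (cong (_+ rank a) (weight-nonzero y hy))

      above-set : ∀ p y → lookup a p ≡ zer → Nonzero y → rank a < rank (a [ p ]≔ y)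
      above-set p y z hy = subst (rank a <_) (sym (rank-set p y z hy)) ≤-refl

      i : Fin n
      i = freeSlot a a<n

      ai : lookup a i ≡ zer
      ai = proj₁ (freeSlot-spec a a<n a>0)

      j : Fin n
      j = proj₁ (otherZero a i (≤-trans (n≤1+n _) wide))

      j≢i : j ≢ i
      j≢i = proj₁ (proj₂ (otherZero a i (≤-trans (n≤1+n _) wide)))

      aj : lookup a j ≡ zer
      aj = proj₂ (proj₂ (otherZero a i (≤-trans (n≤1+n _) wide)))

      ρ : V
      ρ = a [ j ]≔ lookup u j

      ρu : ρ ⊑ u
      ρu = update-below j au refl

      oρ : Inside ρ
      oρ = update-above a j (lookup u j) aj , above-set j (lookup u j) aj (fill-nonzero (firstSign a) a nzA j) ,
           ≤-trans (variation-mono ρu) (proj₂ (proj₂ ou))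

      -- a [ i ]≔ y  ↑  u [ i ]≔ y  ↓  ρ  ↑  u
      slotWalk : ∀ y → Nonzero y → variation (a [ i ]≔ y) ≤ m → Walk K (canon (a [ i ]≔ y)) hub
      slotWalk y hy vy =
        upWalk (inside⇒LinkVertex o1) (inside⇒LinkVertex ow) d1
          (downWalk (inside⇒LinkVertex ow) (inside⇒LinkVertex oρ) d2
            (upWalk (inside⇒LinkVertex oρ) (inside⇒LinkVertex ou) ρu here))
        where
        d1 : a [ i ]≔ y ⊑ u [ i ]≔ y
        d1 = update-⊑-update i i y y au (inj₂ refl) (inj₂ refl) (λ _ → inj₂ refl)
        d2 : ρ ⊑ u [ i ]≔ y
        d2 = update-⊑-update i j (lookup u j) y au (inj₁ ai) (inj₁ (inj₂ refl))
                             (λ e → ⊥-elim (j≢i (sym e)))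
        o1 : Inside (a [ i ]≔ y)
        o1 = update-above a i y ai , above-set i y ai hy , vy
        ow : Inside (u [ i ]≔ y)
        ow = ⊑-trans (update-above a i y ai) d1 , <-≤-trans (above-set i y ai hy) (rank-mono d1) ,
             ≤-trans (proj₂ (freeSlot-spec a a<n a>0) y hy) vy

      fullWalk : ∀ {x} → Inside x → (∀ p → Nonzero (lookup x p)) → Walk K (canon x) hub
      fullWalk {x} ox@(ax , _ , vx) full =
        downWalk (inside⇒LinkVertex ox) (inside⇒LinkVertex o1) d (slotWalk (lookup x i) (full i) v1)
        where
        d : a [ i ]≔ lookup x i ⊑ x
        d = update-below i ax refl
        v1 : variation (a [ i ]≔ lookup x i) ≤ m
        v1 = ≤-trans (variation-mono d) vx
        o1 : Inside (a [ i ]≔ lookup x i)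
        o1 = update-above a i _ ai , above-set i _ ai (full i) , v1

      toHub : ∀ {z} → InP n m z → Lt a z → Walk K z hub
      toHub {z} pz (az , ra) with orientAbove {a = a} {x = z} (≼⇒⊑± az)
      ... | z′ , az′ , e = subst (λ q → Walk K q hub) (canon-rep (proj₁ pz) e)
            (upWalk (inside⇒LinkVertex oz) (inside⇒LinkVertex ox) (fill-sub (firstSign z′) z′)
              (fullWalk ox (fill-nonzero (firstSign z′) z′ (firstSign-nonzero z′ z′>0))))
        where
        rz′ : rank a < rank z′
        rz′ = subst (rank a <_) (sym (rank-rep e)) ra
        z′>0 : 0 < rank z′
        z′>0 = ≤-trans (s≤s z≤n) rz′
        vz′ : variation z′ ≤ m
        vz′ = subst (_≤ m) (sym (variation-rep e)) (InP-variation {z} pz)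
        oz : Inside z′
        oz = az′ , rz′ , vz′
        ox : Inside (fill (firstSign z′) z′)
        ox = ⊑-trans az′ (fill-sub (firstSign z′) z′) ,
             <-≤-trans rz′ (rank-mono (fill-sub (firstSign z′) z′)) ,
             subst (_≤ m) (sym (variation-fill z′ z′>0)) vz′

    -- Width of a gap of F, from the count of the remaining vertices.
    gap-width : ∀ f b ra → suc (suc f) ≤ k → f + b ≡ suc (suc k) + ra → suc (suc (suc (suc ra))) ≤ b
    gap-width f b ra h e = +-cancelˡ-≤ f _ _ (begin
        f + suc (suc (suc (suc ra)))
          ≡⟨ solve 2 (λ f ra → f :+ (con 4 :+ ra) := con 2 :+ ((f :+ con 2) :+ ra)) refl f ra ⟩
        suc (suc ((f + 2) + ra))     ≤⟨ s≤s (s≤s (+-monoˡ-≤ ra (subst (_≤ k) (+-comm 2 f) h))) ⟩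
        suc (suc k) + ra             ≡⟨ sym e ⟩
        f + b                        ∎)
      where open ≤-Reasoning

    -- Walks between two given link vertices v and w, when |F| ≤ n - 3.
    module Connect (lenH : suc (length F) < k) {v w : V} (lv : LinkVertex v) (lw : LinkVertex w) where
      S : Sorted F
      S = sortFace fF

      LL : List V
      LL = Sorted.L S

      wSide : ∀ {f} → f ∈ F → Lt f w ⊎ Lt w f
      wSide i = comparable⇒Lt⊎Gt (proj₁ (faceIn fF i)) (proj₁ (proj₁ lw)) (proj₂ (proj₂ lw) i)
                                  (λ e → proj₁ (proj₂ lw) (subst (_∈ F) e i))

      -- If f separates u from v, then v–u–w or v–w is a walk, whichever side w is on.
      separatedWalk : Separated zeroVec nothing LL v → Walk K v w
      separatedWalk A = across sep (wSide (Sorted.from S fL))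
        where
        open Separated A
        lu : LinkVertex u
        lu = pu , (λ i → proj₂ (fu (Sorted.to S i)) refl) , (λ i → proj₁ (fu (Sorted.to S i)))
        across : Separates f u v → Lt f w ⊎ Lt w f → Walk K v w
        across (inj₁ (uf , fv)) (inj₁ fw) = walk-++ (edgeWalk lv lu (inj₂ (proj₁ (Lt-trans uf fv))))
                                                    (edgeWalk lu lw (inj₁ (proj₁ (Lt-trans uf fw))))
        across (inj₁ (uf , fv)) (inj₂ wf) = edgeWalk lv lw (inj₂ (proj₁ (Lt-trans wf fv)))
        across (inj₂ (vf , fu)) (inj₁ fw) = edgeWalk lv lw (inj₁ (proj₁ (Lt-trans vf fw)))
        across (inj₂ (vf , fu)) (inj₂ wf) = walk-++ (edgeWalk lv lu (inj₁ (proj₁ (Lt-trans vf fu))))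
                                                    (edgeWalk lu lw (inj₂ (proj₁ (Lt-trans wf fu))))

      -- If w is below the bottom a of v's gap, then w < a < v.
      bottomCase : ∀ {a} → a ≡ zeroVec ⊎ a ∈ LL → Lt a v → Lt a w ⊎ Walk K v w
      bottomCase (inj₁ refl) _ = inj₁ (zeroVec≼ w , zeroVec<rank {w} (proj₁ (proj₁ lw)))
      bottomCase (inj₂ i) av with wSide (Sorted.from S i)
      ... | inj₁ aw = inj₁ aw
      ... | inj₂ wa = inj₂ (edgeWalk lv lw (inj₂ (proj₁ (Lt-trans wa av))))

      topGapWalk : ∀ {a} → a ≡ zeroVec ⊎ a ∈ LL → Lt a v → (∀ {y} → y ∈ F → y ≼ a ⊎ ⊥) →
                   suc (suc (suc (suc (rank a)))) ≤ suc n → Walk K v w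
      topGapWalk {a} aOK av outside wide with bottomCase aOK av
      ... | inj₂ p = p
      ... | inj₁ aw = walk-++ (toHub (proj₁ lv) av) (walk-reverse (toHub (proj₁ lw) aw))
        where
        -- a is a vertex: F is nonempty and lies below a.
        a-vertex : a ≡ zeroVec ⊎ a ∈ LL → InP n m a
        a-vertex (inj₂ i) = faceIn fF (Sorted.from S i)
        a-vertex (inj₁ e) with nonempty-member F (proj₁ fF)
        ... | f , i with outside i
        ...   | inj₁ fa = ⊥-elim (<⇒≱ (zeroVec<rank {f} (proj₁ (faceIn fF i)))
                                      (subst (λ q → rank f ≤ rank q) e (rank-mono≼ fa)))
        open TopGap a outside (a-vertex aOK) (≤-pred wide)

      boundedGapWalk : ∀ {a b'} → a ≡ zeroVec ⊎ a ∈ LL → b' ∈ LL → Lt a v → Lt v b' →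
                       (∀ {y} → y ∈ F → y ≼ a ⊎ b' ≼ y) → suc (suc (suc (suc (rank a)))) ≤ rank b' →
                       Walk K v w
      boundedGapWalk {a} {b'} aOK ib av vb outside wide with bottomCase aOK av | wSide (Sorted.from S ib)
      ... | inj₂ p | _ = p
      ... | inj₁ aw | inj₁ bw = edgeWalk lv lw (inj₁ (proj₁ (Lt-trans vb bw)))
      ... | inj₁ aw | inj₂ wb = gapWalk (proj₁ lv) (proj₁ lw) av vb aw wb
        where open BoundedGap a b' outside (faceIn fF (Sorted.from S ib)) (≼-trans (proj₁ av) (proj₁ vb))
                              (≤-trans (n≤1+n _) wide)

      sameGapWalk : SameGap zeroVec nothing LL v → Walk K v w
      sameGapWalk G = dispatch b bOK vb outside cnt
        where
        open SameGap G
        open Gap gap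
        wide : ∀ {b} → length LL + rankH b + rank (zeroVec {n}) ≡ suc n + rank a →
               suc (suc (suc (suc (rank a)))) ≤ rankH b
        wide {b} e = gap-width (length F) (rankH b) (rank a) lenH
          (trans (cong (_+ rankH b) (sym (Sorted.len S)))
            (trans (sym (+-identityʳ _)) (trans (cong (length LL + rankH b +_) (sym rank-zeroVec-n)) e)))
        dispatch : ∀ b → b ≡ nothing ⊎ Σ V (λ b' → b ≡ just b' × b' ∈ LL) →
                   BelowH v b × rank v < rankH b →
                   (∀ {y} → y ∈ LL → y ≼ a ⊎ AboveH b y) →
                   length LL + rankH b + rank (zeroVec {n}) ≡ suc n + rank a → Walk K v w
        dispatch nothing _ _ out e = topGapWalk aOK av (λ i → out (Sorted.to S i)) (wide {nothing} e)
        dispatch (just b') (inj₁ ())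
        dispatch (just b') (inj₂ (_ , refl , ib)) vb′ out e =
          boundedGapWalk aOK ib av vb′ (λ i → out (Sorted.to S i)) (wide {just b'} e)

    link-connected : suc (length F) < k → Connected K
    link-connected lenH v w kv kw with linkVertex kv | linkVertex kw
    ... | lv@(pv , v∉F , cv) | lw =
      connect (separatedOrSameGap (inj₁ refl) top (sortedAll fF S) (Sorted.sc S) pv
                                  (zeroVec-gap v (proj₁ pv)) fits)
      where
      open Connect lenH lv lw
      fits : Fits LL v
      fits i = cv (Sorted.from S i) , (λ e → v∉F (subst (_∈ F) e (Sorted.from S i)))
      connect : Separated zeroVec nothing LL v ⊎ SameGap zeroVec nothing LL v → Walk K v w
      connect (inj₁ A) = separatedWalk A
      connect (inj₂ G) = sameGapWalk G

-- The
-- argument works for every m.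
lemma3p3 : (n m : ℕ) → 1 ≤ n → m ≤ n ∸ 1 →
    NormalPseudomanifold (n ∸ 1) (OrderComplexFace n m)
lemma3p3 zero m () _
lemma3p3 (suc k) m _ _ =
  (bigFace , (λ F → facetLen)) ,
  (λ F fF len G₁ G₂ G₃ → Thinness.thin fF len) ,
  (λ F fF lenH → LinkConnectivity.link-connected fF lenH)
  where open Pseudomanifold k m
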